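{- Let $F$ be a field, $A$ a central simple algebra over $F$, and $\sigma: A \rightarrow A$ an involution of the first kind. If $\sigma$ is orthogonal, then $SL^\sigma(2,A)$ is a symplectic group; otherwise (i.e. if $\sigma$ is symplectic) it is an orthogonal group. More precisely, over an algebraic closure $\overline{F}$, with $A\otimes_F\overline{F}\cong\text{Mat}(n,\overline{F})$, the group $SL^\sigma(2,A\otimes_F \overline{F})$ is the group of elements of $\text{Mat}(2n,\overline{F})$ preserving a nondegenerate bilinear form on $\overline{F}^{2n}$ which is alternating if $\sigma$ is orthogonal and symmetric if $\sigma$ is symplectic.
   Context: An involution on a ring is an additive map $\sigma$ with $\sigma(\sigma(x))=x$ and $\sigma(xy)=\sigma(y)\sigma(x)$; on a central simple $F$-algebra it is of the first kind if it fixes $F$ pointwise. Extending $\sigma$ to $A\otimes_F\overline{F}\cong \text{Mat}(n,\overline{F})$, there is a nonzero bilinear form $b_\sigma$ on $\overline{F}^n$, unique up to scalar, with $b_\sigma(v,Mw) = b_\sigma(\sigma(M)v,w)$; $\sigma$ is orthogonal if $b_\sigma$ is symmetric and symplectic if it is alternating. Define $\hat{\sigma}\begin{pmatrix} a & b \\ c & d\end{pmatrix} = \begin{pmatrix} \sigma(d) & -\sigma(b) \\ -\sigma(c) & \sigma(a)\end{pmatrix}$ and $SL^\sigma(2,R) = \{M\in\text{Mat}(2,R): M\hat{\sigma}(M) = I\}$ for $R = A$ or $A\otimes_F\overline{F}$. -}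

module Defs where

open import Level using (Level; _⊔_)
open import Data.Nat using (ℕ; zero; suc)
import Data.Nat as ℕ
open import Data.Fin using (Fin; zero; suc; splitAt; _↑ˡ_; _↑ʳ_)
open import Data.Sum using (_⊎_; inj₁; inj₂)
open import Data.Product using (_×_; _,_; ∃; ∃-syntax; Σ)
open import Data.List using (List; []; _∷_)
open import Relation.Nullary using (¬_)
open import Function.Bundles using (_⇔_)
open import Algebra.Bundles using (CommutativeRing)

record Field (c ℓ : Level) : Set (Level.suc (c ⊔ ℓ)) where
  field
    commRing : CommutativeRing c ℓ
  open CommutativeRing commRing public
  field
    0≉1     : ¬ (0# ≈ 1#)
    inverse : ∀ x → ¬ (x ≈ 0#) → ∃[ y ] (x * y ≈ 1#)

module FieldTheory {c ℓ} (K : Field c ℓ) where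
  open Field K using (Carrier; _≈_; _+_; _*_; -_; 0#; 1#)

  -- A list [a₀, a₁, …, a_{d-1}] encodes the monic polynomial
  -- x^d + a_{d-1} x^{d-1} + … + a₀  (d = length, required ≥ 1).
  evalWith : List Carrier → Carrier → Carrier → Carrier
  evalWith []       lead x = lead
  evalWith (a ∷ as) lead x = a + x * evalWith as lead x

  AlgebraicallyClosed : Set (c ⊔ ℓ)
  AlgebraicallyClosed =
    ∀ (a : Carrier) (as : List Carrier) → ∃[ x ] (evalWith (a ∷ as) 1# x ≈ 0#)

  Σ[<_]_ : (n : ℕ) → (Fin n → Carrier) → Carrier
  Σ[< zero  ] f = 0#
  Σ[< suc n ] f = f zero + Σ[< n ] (λ i → f (suc i))

  Vec : ℕ → Set c
  Vec n = Fin n → Carrier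

  Mat : ℕ → Set c
  Mat n = Fin n → Fin n → Carrier

  _≈v_ : ∀ {n} → Vec n → Vec n → Set ℓ
  v ≈v w = ∀ i → v i ≈ w i

  _≈M_ : ∀ {n} → Mat n → Mat n → Set ℓ
  M ≈M N = ∀ i j → M i j ≈ N i j

  0v : ∀ {n} → Vec n
  0v _ = 0#

  _+M_ : ∀ {n} → Mat n → Mat n → Mat n
  (M +M N) i j = M i j + N i j

  -M_ : ∀ {n} → Mat n → Mat n
  (-M M) i j = - M i j

  _*M_ : ∀ {n} → Mat n → Mat n → Mat n
  (M *M N) i j = Σ[< _ ] (λ k → M i k * N k j)

  _·v_ : ∀ {n} → Mat n → Vec n → Vec n
  (M ·v v) i = Σ[< _ ] (λ k → M i k * v k)

  0M : ∀ {n} → Mat n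
  0M _ _ = 0#

  scalarM : ∀ {n} → Carrier → Mat n
  scalarM {suc n} a zero    zero    = a
  scalarM {suc n} a zero    (suc j) = 0#
  scalarM {suc n} a (suc i) zero    = 0#
  scalarM {suc n} a (suc i) (suc j) = scalarM a i j

  1M : ∀ {n} → Mat n
  1M = scalarM 1#

  record IsInvolutionFirstKind (n : ℕ) (σ : Mat n → Mat n) : Set (c ⊔ ℓ) where
    field
      cong       : ∀ {M N} → M ≈M N → σ M ≈M σ N
      additive   : ∀ M N → σ (M +M N) ≈M (σ M +M σ N)
      involutive : ∀ M → σ (σ M) ≈M M
      antimult   : ∀ M N → σ (M *M N) ≈M (σ N *M σ M)
      firstKind  : ∀ a → σ (scalarM a) ≈M scalarM a   -- fixes the centre K

  bil : ∀ {n} → Mat n → Vec n → Vec n → Carrier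
  bil B v w = Σ[< _ ] (λ i → Σ[< _ ] (λ j → v i * (B i j * w j)))

  NonzeroForm : ∀ {n} → Mat n → Set ℓ
  NonzeroForm B = ∃[ i ] ∃[ j ] ¬ (B i j ≈ 0#)

  SymmetricForm : ∀ {n} → Mat n → Set (c ⊔ ℓ)
  SymmetricForm B = ∀ v w → bil B v w ≈ bil B w v

  AlternatingForm : ∀ {n} → Mat n → Set (c ⊔ ℓ)
  AlternatingForm B = ∀ v → bil B v v ≈ 0#

  NondegenerateForm : ∀ {n} → Mat n → Set (c ⊔ ℓ)
  NondegenerateForm B = ∀ v → (∀ w → bil B v w ≈ 0#) → v ≈v 0v

  AdaptedForm : ∀ {n} → (Mat n → Mat n) → Mat n → Set (c ⊔ ℓ)
  AdaptedForm σ B = ∀ M v w → bil B v (M ·v w) ≈ bil B (σ M ·v v) w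

  -- σ orthogonal / symplectic: its (nonzero, unique up to scalar) adapted
  -- form b_σ is symmetric / alternating.
  Orthogonal : ∀ {n} → (Mat n → Mat n) → Set (c ⊔ ℓ)
  Orthogonal σ = ∃[ B ] (NonzeroForm B × AdaptedForm σ B × SymmetricForm B)

  Symplectic : ∀ {n} → (Mat n → Mat n) → Set (c ⊔ ℓ)
  Symplectic σ = ∃[ B ] (NonzeroForm B × AdaptedForm σ B × AlternatingForm B)

  record Mat2 (n : ℕ) : Set c where
    constructor mat2
    field
      a b c' d : Mat n

  _*2_ : ∀ {n} → Mat2 n → Mat2 n → Mat2 n
  mat2 a b c' d *2 mat2 a' b' c'' d' =
    mat2 ((a *M a') +M (b *M c'')) ((a *M b') +M (b *M d'))
         ((c' *M a') +M (d *M c'')) ((c' *M b') +M (d *M d'))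

  _≈2_ : ∀ {n} → Mat2 n → Mat2 n → Set ℓ
  mat2 a b c' d ≈2 mat2 a' b' c'' d' = (a ≈M a') × (b ≈M b') × (c' ≈M c'') × (d ≈M d')

  I2 : ∀ {n} → Mat2 n
  I2 = mat2 1M 0M 0M 1M

  σhat : ∀ {n} → (Mat n → Mat n) → Mat2 n → Mat2 n
  σhat σ (mat2 a b c' d) = mat2 (σ d) (-M (σ b)) (-M (σ c')) (σ a)

  InSLσ : ∀ {n} → (Mat n → Mat n) → Mat2 n → Set ℓ
  InSLσ σ M = (M *2 σhat σ M) ≈2 I2

  -- Identification Mat(2n, K) ≅ Mat(2, Mat(n, K)) by 2×2 blocks,
  -- using Fin (n + n) = Fin n ⊎ Fin n (first block, second block).
  toBlocks : ∀ {n} → Mat (n ℕ.+ n) → Mat2 n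
  toBlocks {n} g = mat2 (λ i j → g (i ↑ˡ n) (j ↑ˡ n)) (λ i j → g (i ↑ˡ n) (n ↑ʳ j))
                        (λ i j → g (n ↑ʳ i) (j ↑ˡ n)) (λ i j → g (n ↑ʳ i) (n ↑ʳ j))

  Preserves : ∀ {m} → Mat m → Mat m → Set (c ⊔ ℓ)
  Preserves B g = ∀ v w → bil B (g ·v v) (g ·v w) ≈ bil B v w

-- Let B be the Gram matrix of b_σ, so that b(v, M w) = b(σ(M) v, w). On K^n ⊕ K^n put
-- Ω((v₁ , v₂) , (w₁ , w₂)) = b(v₁ , w₂) − b(v₂ , w₁): it is alternating when b is symmetric,
-- symmetric when b is alternating, and nondegenerate since a nonzero adapted form is.
-- A block computation gives Ω(g v , u) = Ω(v , τ(g) u), where τ(g) is the block matrix σ̂(g),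
-- so g preserves Ω iff τ(g) g = 1, whereas g ∈ SL^σ(2) iff g τ(g) = 1. These agree because a
-- one-sided inverse of a square matrix is two-sided, by det(A B) = det A · det B and the adjugate.
module Submission where

open import Defs
open import Level using (Level; _⊔_)
open import Data.Nat using (ℕ; zero; suc; z≤n)
import Data.Nat as ℕ
import Data.Nat.Properties as ℕ
open import Data.Fin using (Fin; zero; suc; punchIn; inject₁; toℕ; fromℕ<; splitAt; join; _↑ˡ_; _↑ʳ_)
import Data.Fin.Properties as Fin
open import Data.Vec.Functional using (updateAt; insertAt; _++_)
import Data.Vec.Functional.Properties as Vector
open import Data.Sum using (_⊎_; inj₁; inj₂)
open import Data.Product using (_×_; _,_; ∃-syntax; proj₁; proj₂)
open import Data.Maybe using (Maybe; nothing; just)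
open import Data.Empty using (⊥-elim)
open import Function using (const)
open import Function.Bundles using (_⇔_; mk⇔; Equivalence)
open import Relation.Binary.PropositionalEquality as ≡ using (_≡_; _≢_)
open import Relation.Nullary using (Dec; yes; no)
import Relation.Binary.Reasoning.Setoid as SetoidReasoning
open import Algebra.Bundles using (CommutativeRing; RawRing)
open import Algebra.Solver.Ring.AlmostCommutativeRing using (fromCommutativeRing; _-Raw-AlmostCommutative⟶_)
import Algebra.Properties.Ring as RingProperties

-- Pairs (p , n) of naturals, read as p − n, serve as coefficients: they have decidable
-- equality, so the solver normalises without any decidability assumption on the ring.
module CommutativeRingSolver {c ℓ} (R : CommutativeRing c ℓ) where
  open CommutativeRing R
  open import Algebra.Properties.Semiring.Mult semiring using (×-homo-+; ×1-homo-*; ×-congˡ) renaming (_×_ to _×ₙ_)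
  open RingProperties ring using (-‿+-comm; -0#≈0#; ⁻¹-anti-homo‿-; x[y-z]≈xy-xz; [y-z]x≈yx-zx)
  open import Algebra.Properties.CommutativeSemigroup +-commutativeSemigroup using (interchange)
  open SetoidReasoning setoid

  differences : RawRing Level.zero Level.zero
  differences = record
    { Carrier = ℕ × ℕ
    ; _≈_     = _≡_
    ; _+_     = λ { (p , n) (p′ , n′) → p ℕ.+ p′ , n ℕ.+ n′ }
    ; _*_     = λ { (p , n) (p′ , n′) → p ℕ.* p′ ℕ.+ n ℕ.* n′ , p ℕ.* n′ ℕ.+ n ℕ.* p′ }
    ; -_      = λ { (p , n) → n , p }
    ; 0#      = 0 , 0
    ; 1#      = 1 , 0
    }

  ⟦_⟧ : ℕ × ℕ → Carrier
  ⟦ p , n ⟧ = p ×ₙ 1# - n ×ₙ 1#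

  -‿+-interchange : ∀ a b c d → (a - b) + (c - d) ≈ (a + c) - (b + d)
  -‿+-interchange a b c d = trans (interchange a (- b) c (- d)) (+-congˡ (-‿+-comm b d))

  -‿cross : ∀ {a b c d} → a + d ≈ c + b → a - b ≈ c - d
  -‿cross {a} {b} {c} {d} a+d≈c+b = begin
    a - b                     ≈⟨ +-identityʳ _ ⟨
    (a - b) + 0#              ≈⟨ +-congˡ (-‿inverseʳ d) ⟨
    (a - b) + (d - d)         ≈⟨ -‿+-interchange a b d d ⟩
    (a + d) - (b + d)         ≈⟨ +-cong a+d≈c+b (-‿cong (+-comm b d)) ⟩
    (c + b) - (d + b)         ≈⟨ -‿+-interchange c d b b ⟨
    (c - d) + (b - b)         ≈⟨ +-congˡ (-‿inverseʳ b) ⟩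
    (c - d) + 0#              ≈⟨ +-identityʳ _ ⟩
    c - d                     ∎

  homomorphism : differences -Raw-AlmostCommutative⟶ fromCommutativeRing R
  homomorphism = record
    { ⟦_⟧    = ⟦_⟧
    ; +-homo = λ { (p , n) (p′ , n′) → trans (+-cong (×-homo-+ 1# p p′) (-‿cong (×-homo-+ 1# n n′)))
                                             (sym (-‿+-interchange _ _ _ _)) }
    ; *-homo = λ { (p , n) (p′ , n′) → let P = p ×ₙ 1#; N = n ×ₙ 1#; P′ = p′ ×ₙ 1#; N′ = n′ ×ₙ 1# in begin
        (p ℕ.* p′ ℕ.+ n ℕ.* n′) ×ₙ 1# - (p ℕ.* n′ ℕ.+ n ℕ.* p′) ×ₙ 1#
          ≈⟨ +-cong (trans (×-homo-+ 1# (p ℕ.* p′) (n ℕ.* n′)) (+-cong (×1-homo-* p p′) (×1-homo-* n n′)))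
                    (-‿cong (trans (×-homo-+ 1# (p ℕ.* n′) (n ℕ.* p′)) (+-cong (×1-homo-* p n′) (×1-homo-* n p′)))) ⟩
        (P * P′ + N * N′) - (P * N′ + N * P′)    ≈⟨ trans (+-congˡ (⁻¹-anti-homo‿- _ _)) (-‿+-interchange _ _ _ _) ⟨
        (P * P′ - P * N′) - (N * P′ - N * N′)
          ≈⟨ +-cong (x[y-z]≈xy-xz P P′ N′) (-‿cong (x[y-z]≈xy-xz N P′ N′)) ⟨
        P * (P′ - N′) - N * (P′ - N′)            ≈⟨ [y-z]x≈yx-zx (P′ - N′) P N ⟨
        (P - N) * (P′ - N′)                      ∎ }
    ; -‿homo = λ { (p , n) → sym (⁻¹-anti-homo‿- _ _) }
    ; 0-homo = -‿inverseʳ 0#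
    ; 1-homo = trans (+-cong (+-identityʳ 1#) -0#≈0#) (+-identityʳ 1#)
    }

  coefficient≟ : (a b : ℕ × ℕ) → Maybe (⟦ a ⟧ ≈ ⟦ b ⟧)
  coefficient≟ (p , n) (p′ , n′) with p ℕ.+ n′ ℕ.≟ p′ ℕ.+ n
  ... | no _  = nothing
  ... | yes e = just (-‿cross (trans (sym (×-homo-+ 1# p n′)) (trans (×-congˡ e) (×-homo-+ 1# p′ n))))

  open import Algebra.Solver.Ring differences (fromCommutativeRing R) homomorphism coefficient≟ public
    using (solve; _:=_; _:+_; _:*_; :-_; _:-_)

module LinearAlgebra {c ℓ} (K : Field c ℓ) where
  open Field K hiding (zero)
  open FieldTheory K
  open RingProperties ring
    using (-‿involutive; -‿injective; -‿distribˡ-*; -‿distribʳ-*; -0#≈0#; -‿+-comm; +-inverseʳ-unique; x∙y⁻¹≈ε⇒x≈y)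
  open SetoidReasoning setoid

  open import Algebra.Properties.CommutativeSemigroup +-commutativeSemigroup using (interchange)
  open CommutativeRingSolver commRing using (solve; _:=_; _:+_; _:*_; :-_; _:-_)

  Σ-cong : ∀ {n} {f g : Fin n → Carrier} → (∀ i → f i ≈ g i) → Σ[< n ] f ≈ Σ[< n ] g
  Σ-cong {zero}  f≈g = refl
  Σ-cong {suc n} f≈g = +-cong (f≈g zero) (Σ-cong (λ i → f≈g (suc i)))

  Σ-zero : ∀ {n} {f : Fin n → Carrier} → (∀ i → f i ≈ 0#) → Σ[< n ] f ≈ 0#
  Σ-zero {zero}  f≈0 = refl
  Σ-zero {suc n} f≈0 = trans (+-cong (f≈0 zero) (Σ-zero (λ i → f≈0 (suc i)))) (+-identityˡ 0#)

  Σ-distrib-+ : ∀ {n} (f g : Fin n → Carrier) → Σ[< n ] (λ i → f i + g i) ≈ Σ[< n ] f + Σ[< n ] g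
  Σ-distrib-+ {zero}  f g = sym (+-identityˡ 0#)
  Σ-distrib-+ {suc n} f g = trans (+-congˡ (Σ-distrib-+ (λ i → f (suc i)) (λ i → g (suc i)))) (interchange _ _ _ _)

  *-distribˡ-Σ : ∀ {n} a (f : Fin n → Carrier) → a * Σ[< n ] f ≈ Σ[< n ] (λ i → a * f i)
  *-distribˡ-Σ {zero}  a f = zeroʳ a
  *-distribˡ-Σ {suc n} a f = trans (distribˡ a _ _) (+-congˡ (*-distribˡ-Σ a (λ i → f (suc i))))

  *-distribʳ-Σ : ∀ {n} a (f : Fin n → Carrier) → Σ[< n ] f * a ≈ Σ[< n ] (λ i → f i * a)
  *-distribʳ-Σ {n} a f = trans (*-comm _ a) (trans (*-distribˡ-Σ a f) (Σ-cong {n} (λ i → *-comm a (f i))))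

  -‿distrib-Σ : ∀ {n} (f : Fin n → Carrier) → Σ[< n ] (λ i → - f i) ≈ - Σ[< n ] f
  -‿distrib-Σ {zero}  f = sym -0#≈0#
  -‿distrib-Σ {suc n} f = trans (+-congˡ (-‿distrib-Σ (λ i → f (suc i)))) (-‿+-comm _ _)

  Σ-comm : ∀ {m n} (f : Fin m → Fin n → Carrier) →
    Σ[< m ] (λ i → Σ[< n ] (f i)) ≈ Σ[< n ] (λ j → Σ[< m ] (λ i → f i j))
  Σ-comm {zero} {n} f = sym (Σ-zero {n} (λ _ → refl))
  Σ-comm {suc m} {n} f = trans (+-congˡ (Σ-comm (λ i → f (suc i)))) (sym (Σ-distrib-+ {n} _ _))

  Σ-splitAt : ∀ m {n} (f : Fin (m ℕ.+ n) → Carrier) →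
    Σ[< m ℕ.+ n ] f ≈ Σ[< m ] (λ i → f (i ↑ˡ n)) + Σ[< n ] (λ j → f (m ↑ʳ j))
  Σ-splitAt zero    f = sym (+-identityˡ _)
  Σ-splitAt (suc m) f = trans (+-congˡ (Σ-splitAt m (λ i → f (suc i)))) (sym (+-assoc _ _ _))

  1M-diag : ∀ {n} (i : Fin n) → 1M i i ≈ 1#
  1M-diag zero    = refl
  1M-diag (suc i) = 1M-diag i

  1M-≢ : ∀ {n} {i j : Fin n} → i ≢ j → 1M i j ≈ 0#
  1M-≢ {i = zero}  {zero}  i≢j = ⊥-elim (i≢j ≡.refl)
  1M-≢ {i = zero}  {suc j} i≢j = refl
  1M-≢ {i = suc i} {zero}  i≢j = refl
  1M-≢ {i = suc i} {suc j} i≢j = 1M-≢ (λ i≡j → i≢j (≡.cong suc i≡j))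

  1M-sym : ∀ {n} (i j : Fin n) → 1M i j ≈ 1M j i
  1M-sym zero    zero    = refl
  1M-sym zero    (suc j) = refl
  1M-sym (suc i) zero    = refl
  1M-sym (suc i) (suc j) = 1M-sym i j

  Σ-1Mˡ : ∀ {n} (i : Fin n) (f : Fin n → Carrier) → Σ[< n ] (λ k → 1M i k * f k) ≈ f i
  Σ-1Mˡ {suc n} zero    f = trans (+-cong (*-identityˡ _) (Σ-zero {n} (λ k → zeroˡ _))) (+-identityʳ _)
  Σ-1Mˡ {suc n} (suc i) f = trans (+-cong (zeroˡ _) (Σ-1Mˡ i (λ k → f (suc k)))) (+-identityˡ _)

  Σ-1Mʳ : ∀ {n} (i : Fin n) (f : Fin n → Carrier) → Σ[< n ] (λ k → f k * 1M k i) ≈ f i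
  Σ-1Mʳ {n} i f = trans (Σ-cong {n} (λ k → trans (*-comm _ _) (*-congʳ (1M-sym k i)))) (Σ-1Mˡ i f)

  ≈M-refl : ∀ {n} {A : Mat n} → A ≈M A
  ≈M-refl i j = refl

  ≈M-sym : ∀ {n} {A B : Mat n} → A ≈M B → B ≈M A
  ≈M-sym A≈B i j = sym (A≈B i j)

  ≈M-trans : ∀ {n} {A B C : Mat n} → A ≈M B → B ≈M C → A ≈M C
  ≈M-trans A≈B B≈C i j = trans (A≈B i j) (B≈C i j)

  *M-cong : ∀ {n} {A A′ B B′ : Mat n} → A ≈M A′ → B ≈M B′ → (A *M B) ≈M (A′ *M B′)
  *M-cong {n} A≈A′ B≈B′ i j = Σ-cong {n} (λ k → *-cong (A≈A′ i k) (B≈B′ k j))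

  *M-assoc : ∀ {n} (A B C : Mat n) → ((A *M B) *M C) ≈M (A *M (B *M C))
  *M-assoc {n} A B C i j = begin
    Σ[< n ] (λ k → Σ[< n ] (λ l → A i l * B l k) * C k j)   ≈⟨ Σ-cong {n} (λ k → *-distribʳ-Σ {n} _ _) ⟩
    Σ[< n ] (λ k → Σ[< n ] (λ l → A i l * B l k * C k j))   ≈⟨ Σ-comm {n} {n} _ ⟩
    Σ[< n ] (λ l → Σ[< n ] (λ k → A i l * B l k * C k j))   ≈⟨ Σ-cong {n} (λ l → Σ-cong {n} (λ k → *-assoc _ _ _)) ⟩
    Σ[< n ] (λ l → Σ[< n ] (λ k → A i l * (B l k * C k j))) ≈⟨ Σ-cong {n} (λ l → *-distribˡ-Σ {n} _ _) ⟨
    Σ[< n ] (λ l → A i l * Σ[< n ] (λ k → B l k * C k j))   ∎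

  *M-identityˡ : ∀ {n} (A : Mat n) → (1M *M A) ≈M A
  *M-identityˡ A i j = Σ-1Mˡ i (λ k → A k j)

  *M-identityʳ : ∀ {n} (A : Mat n) → (A *M 1M) ≈M A
  *M-identityʳ A i j = Σ-1Mʳ j (A i)

  infixl 6 _+ᵥ_
  infixl 7 _*ᵥ_

  _+ᵥ_ : ∀ {n} → Vec n → Vec n → Vec n
  (v +ᵥ w) i = v i + w i

  _*ᵥ_ : ∀ {n} → Carrier → Vec n → Vec n
  (a *ᵥ v) i = a * v i

  setRow : ∀ {m n} → (Fin m → Vec n) → Fin m → Vec n → Fin m → Vec n
  setRow A i v = updateAt A i (const v)

  swapRows : ∀ {m n} → (Fin m → Vec n) → Fin m → Fin m → Fin m → Vec n
  swapRows A i j = setRow (setRow A i (A j)) j (A i)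

  ≗⇒≈M : ∀ {m n} {A B : Fin m → Vec n} → (∀ r → A r ≡ B r) → ∀ r → A r ≈v B r
  ≗⇒≈M A≗B r j = reflexive (≡.cong-app (A≗B r) j)

  setRow-same : ∀ {m n} (A : Fin m → Vec n) i v → setRow A i v i ≈v v
  setRow-same A i v j = reflexive (≡.cong-app (Vector.updateAt-updates i A) j)

  setRow-other : ∀ {m n} (A : Fin m → Vec n) {i r} v → i ≢ r → setRow A i v r ≈v A r
  setRow-other A {i} {r} v i≢r j = reflexive (≡.cong-app (Vector.updateAt-minimal r i A (λ r≡i → i≢r (≡.sym r≡i))) j)

  setRow-self : ∀ {m n} (A : Fin m → Vec n) i → ∀ r → setRow A i (A i) r ≈v A r
  setRow-self A i = ≗⇒≈M (Vector.updateAt-id-local i A ≡.refl)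

  setRow-comm : ∀ {m n} (A : Fin m → Vec n) {i j} x y → i ≢ j →
    ∀ r → setRow (setRow A i x) j y r ≈v setRow (setRow A j y) i x r
  setRow-comm A {i} {j} x y i≢j = ≗⇒≈M (Vector.updateAt-commutes j i (λ j≡i → i≢j (≡.sym j≡i)) A)

  setRow-cong : ∀ {m n} (A : Fin m → Vec n) i {v w} → v ≈v w → ∀ r → setRow A i v r ≈v setRow A i w r
  setRow-cong A zero    v≈w zero    = v≈w
  setRow-cong A zero    v≈w (suc r) = λ _ → refl
  setRow-cong A (suc i) v≈w zero    = λ _ → refl
  setRow-cong A (suc i) v≈w (suc r) = setRow-cong (λ r → A (suc r)) i v≈w r

  setRow-congˡ : ∀ {m n} {A B : Fin m → Vec n} i v → (∀ r → A r ≈v B r) → ∀ r → setRow A i v r ≈v setRow B i v r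
  setRow-congˡ zero    v A≈B zero    = λ _ → refl
  setRow-congˡ zero    v A≈B (suc r) = A≈B (suc r)
  setRow-congˡ (suc i) v A≈B zero    = A≈B zero
  setRow-congˡ (suc i) v A≈B (suc r) = setRow-congˡ i v (λ r → A≈B (suc r)) r

  record IsAlternatingMultilinear {m} (D : Mat m → Carrier) : Set (c ⊔ ℓ) where
    field
      cong        : ∀ {A B} → A ≈M B → D A ≈ D B
      additive    : ∀ A i v w → D (setRow A i (v +ᵥ w)) ≈ D (setRow A i v) + D (setRow A i w)
      homogeneous : ∀ A i a v → D (setRow A i (a *ᵥ v)) ≈ a * D (setRow A i v)
      alternating : ∀ A {i j} → i ≢ j → A i ≈v A j → D A ≈ 0#

  module AlternatingMultilinear {m} {D : Mat m → Carrier} (isAM : IsAlternatingMultilinear D) where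
    open IsAlternatingMultilinear isAM public

    zeroRow : ∀ A i → D (setRow A i 0v) ≈ 0#
    zeroRow A i = begin
      D (setRow A i 0v)          ≈⟨ cong (setRow-cong A i (λ _ → zeroˡ 0#)) ⟨
      D (setRow A i (0# *ᵥ 0v))  ≈⟨ homogeneous A i 0# 0v ⟩
      0# * D (setRow A i 0v)     ≈⟨ zeroˡ _ ⟩
      0#                         ∎

    linearCombination : ∀ N A i (t : Fin N → Carrier) (u : Fin N → Vec m) →
      D (setRow A i (λ j → Σ[< N ] (λ k → t k * u k j))) ≈ Σ[< N ] (λ k → t k * D (setRow A i (u k)))
    linearCombination zero    A i t u = zeroRow A i
    linearCombination (suc N) A i t u = begin
      D (setRow A i (t zero *ᵥ u zero +ᵥ rest))
        ≈⟨ additive A i _ _ ⟩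
      D (setRow A i (t zero *ᵥ u zero)) + D (setRow A i rest)
        ≈⟨ +-cong (homogeneous A i _ _) (linearCombination N A i (λ k → t (suc k)) (λ k → u (suc k))) ⟩
      t zero * D (setRow A i (u zero)) + Σ[< N ] (λ k → t (suc k) * D (setRow A i (u (suc k)))) ∎
      where
      rest : Vec m
      rest j = Σ[< N ] (λ k → t (suc k) * u (suc k) j)

    addMultipleOfRow : ∀ A {i j} a → i ≢ j → D (setRow A j (A j +ᵥ a *ᵥ A i)) ≈ D A
    addMultipleOfRow A {i} {j} a i≢j = begin
      D (setRow A j (A j +ᵥ a *ᵥ A i))               ≈⟨ additive A j _ _ ⟩
      D (setRow A j (A j)) + D (setRow A j (a *ᵥ A i)) ≈⟨ +-cong (cong (setRow-self A j)) (homogeneous A j a _) ⟩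
      D A + a * D (setRow A j (A i))                   ≈⟨ +-congˡ (*-congˡ (alternating _ i≢j repeated)) ⟩
      D A + a * 0#                                     ≈⟨ trans (+-congˡ (zeroʳ a)) (+-identityʳ _) ⟩
      D A                                              ∎
      where
      repeated : setRow A j (A i) i ≈v setRow A j (A i) j
      repeated x = trans (setRow-other A _ (λ j≡i → i≢j (≡.sym j≡i)) x) (sym (setRow-same A j (A i) x))

    swap : ∀ A {i j} → i ≢ j → D (swapRows A i j) ≈ - D A
    swap A {i} {j} i≢j = +-inverseʳ-unique _ _ (begin
      D A + S y x
        ≈⟨ +-cong (trans (+-cong (S-repeated x) S-original) (+-identityˡ _))
                  (trans (+-congˡ (S-repeated y)) (+-identityʳ _)) ⟨
      (S x x + S x y) + (S y x + S y y)      ≈⟨ +-cong (additive _ j x y) (additive _ j x y) ⟨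
      S x (x +ᵥ y) + S y (x +ᵥ y)            ≈⟨ additiveˡ x y (x +ᵥ y) ⟨
      S (x +ᵥ y) (x +ᵥ y)                    ≈⟨ S-repeated (x +ᵥ y) ⟩
      0#                                     ∎)
      where
      x = A i
      y = A j
      -- S is additive in each argument and vanishes on the diagonal, hence is skew.
      S : Vec m → Vec m → Carrier
      S p q = D (setRow (setRow A i p) j q)
      j≢i : j ≢ i
      j≢i j≡i = i≢j (≡.sym j≡i)
      S-repeated : ∀ z → S z z ≈ 0#
      S-repeated z = alternating _ i≢j (λ k → trans (setRow-other _ z j≢i k)
                                       (trans (setRow-same A i z k) (sym (setRow-same _ j z k))))
      S-original : S x y ≈ D A
      S-original = cong (≈M-trans (setRow-congˡ j y (setRow-self A i)) (setRow-self A j))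
      additiveˡ : ∀ p p′ q → S (p +ᵥ p′) q ≈ S p q + S p′ q
      additiveˡ p p′ q = begin
        S (p +ᵥ p′) q                                  ≈⟨ cong (setRow-comm A _ q i≢j) ⟩
        D (setRow (setRow A j q) i (p +ᵥ p′))           ≈⟨ additive _ i p p′ ⟩
        D (setRow (setRow A j q) i p) + D (setRow (setRow A j q) i p′)
          ≈⟨ +-cong (cong (setRow-comm A q p j≢i)) (cong (setRow-comm A q p′ j≢i)) ⟩
        S p q + S p′ q                                  ∎

  -- The determinant, by expansion along the first row

  sgn : ∀ {n} → Fin n → Carrier
  sgn zero    = 1#
  sgn (suc k) = - sgn k

  minor : ∀ {m} → Fin (suc m) → Mat (suc m) → Mat m
  minor k A i j = A (suc i) (punchIn k j)

  laplace : ∀ {n} → Vec n → (Fin n → Carrier) → Carrier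
  laplace {n} r d = Σ[< n ] (λ k → sgn k * (r k * d k))

  laplace-cong : ∀ {n} {r r′ : Vec n} {d d′ : Fin n → Carrier} →
    r ≈v r′ → (∀ k → d k ≈ d′ k) → laplace r d ≈ laplace r′ d′
  laplace-cong {n} r≈r′ d≈d′ = Σ-cong {n} (λ k → *-congˡ (*-cong (r≈r′ k) (d≈d′ k)))

  laplace-congʳ : ∀ {n} (r : Vec n) {d d′ : Fin n → Carrier} → (∀ k → d k ≈ d′ k) → laplace r d ≈ laplace r d′
  laplace-congʳ r = laplace-cong {r = r} (λ _ → refl)

  laplace-+ᵥ : ∀ {n} (v w : Vec n) d → laplace (v +ᵥ w) d ≈ laplace v d + laplace w d
  laplace-+ᵥ {n} v w d = trans (Σ-cong {n} (λ k → solve 4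
      (λ s a b e → s :* ((a :+ b) :* e) := s :* (a :* e) :+ s :* (b :* e)) refl (sgn k) (v k) (w k) (d k)))
    (Σ-distrib-+ {n} _ _)

  laplace-*ᵥ : ∀ {n} a (v : Vec n) d → laplace (a *ᵥ v) d ≈ a * laplace v d
  laplace-*ᵥ {n} a v d = trans (Σ-cong {n} (λ k → solve 4
      (λ s a b e → s :* ((a :* b) :* e) := a :* (s :* (b :* e))) refl (sgn k) a (v k) (d k)))
    (sym (*-distribˡ-Σ {n} a _))

  laplace-+ : ∀ {n} (r : Vec n) d e → laplace r (λ k → d k + e k) ≈ laplace r d + laplace r e
  laplace-+ {n} r d e = trans (Σ-cong {n} (λ k → solve 4
      (λ s a x y → s :* (a :* (x :+ y)) := s :* (a :* x) :+ s :* (a :* y)) refl (sgn k) (r k) (d k) (e k)))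
    (Σ-distrib-+ {n} _ _)

  laplace-* : ∀ {n} (r : Vec n) a d → laplace r (λ k → a * d k) ≈ a * laplace r d
  laplace-* {n} r a d = trans (Σ-cong {n} (λ k → solve 4
      (λ s b a x → s :* (b :* (a :* x)) := a :* (s :* (b :* x))) refl (sgn k) (r k) a (d k)))
    (sym (*-distribˡ-Σ {n} a _))

  laplace-neg : ∀ {n} (r : Vec n) d → laplace r (λ k → - d k) ≈ - laplace r d
  laplace-neg {n} r d = trans (Σ-cong {n} (λ k → trans (*-congˡ (sym (-‿distribʳ-* _ _))) (sym (-‿distribʳ-* _ _))))
                              (-‿distrib-Σ {n} _)

  laplace-zero : ∀ {n} (r : Vec n) {d} → (∀ k → d k ≈ 0#) → laplace r d ≈ 0#
  laplace-zero {n} r d≈0 = Σ-zero {n} (λ k → trans (*-congˡ (trans (*-congˡ (d≈0 k)) (zeroʳ _))) (zeroʳ _))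

  det : ∀ {m} → Mat m → Carrier
  det {zero}  A = 1#
  det {suc m} A = laplace (A zero) (λ k → det (minor k A))

  det-cong : ∀ {m} {A B : Mat m} → A ≈M B → det A ≈ det B
  det-cong {zero}  A≈B = refl
  det-cong {suc m} A≈B = laplace-cong (A≈B zero) (λ k → det-cong (λ i j → A≈B (suc i) (punchIn k j)))

  minor-setRow : ∀ {m} k (A : Mat (suc m)) i v →
    minor k (setRow A (suc i) v) ≈M setRow (minor k A) i (λ j → v (punchIn k j))
  minor-setRow k A i v = ≗⇒≈M (Vector.map-updateAt {f = λ row j → row (punchIn k j)} (λ _ → ≡.refl) (λ r → A (suc r)) i)

  det-setRow-suc : ∀ {m} (A : Mat (suc m)) i v →
    det (setRow A (suc i) v) ≈ laplace (A zero) (λ k → det (setRow (minor k A) i (λ j → v (punchIn k j))))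
  det-setRow-suc A i v = laplace-congʳ (A zero) (λ k → det-cong (minor-setRow k A i v))

  det-additive : ∀ {m} (A : Mat m) i v w → det (setRow A i (v +ᵥ w)) ≈ det (setRow A i v) + det (setRow A i w)
  det-additive {suc m} A zero    v w = laplace-+ᵥ v w (λ k → det (minor k A))
  det-additive {suc m} A (suc i) v w = begin
    det (setRow A (suc i) (v +ᵥ w))                       ≈⟨ det-setRow-suc A i _ ⟩
    laplace (A zero) (λ k → det (setRow (minor k A) i (v′ k +ᵥ w′ k)))
      ≈⟨ laplace-congʳ (A zero) (λ k → det-additive (minor k A) i (v′ k) (w′ k)) ⟩
    laplace (A zero) (λ k → det (setRow (minor k A) i (v′ k)) + det (setRow (minor k A) i (w′ k)))
      ≈⟨ laplace-+ (A zero) (λ k → det (setRow (minor k A) i (v′ k))) (λ k → det (setRow (minor k A) i (w′ k))) ⟩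
    laplace (A zero) (λ k → det (setRow (minor k A) i (v′ k)))
      + laplace (A zero) (λ k → det (setRow (minor k A) i (w′ k)))
      ≈⟨ +-cong (det-setRow-suc A i v) (det-setRow-suc A i w) ⟨
    det (setRow A (suc i) v) + det (setRow A (suc i) w)    ∎
    where
    v′ w′ : Fin (suc m) → Vec m
    v′ k j = v (punchIn k j)
    w′ k j = w (punchIn k j)

  det-homogeneous : ∀ {m} (A : Mat m) i a v → det (setRow A i (a *ᵥ v)) ≈ a * det (setRow A i v)
  det-homogeneous {suc m} A zero    a v = laplace-*ᵥ a v (λ k → det (minor k A))
  det-homogeneous {suc m} A (suc i) a v = begin
    det (setRow A (suc i) (a *ᵥ v))                                   ≈⟨ det-setRow-suc A i _ ⟩
    laplace (A zero) (λ k → det (setRow (minor k A) i (a *ᵥ v′ k)))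
      ≈⟨ laplace-congʳ (A zero) (λ k → det-homogeneous (minor k A) i a (v′ k)) ⟩
    laplace (A zero) (λ k → a * det (setRow (minor k A) i (v′ k)))
      ≈⟨ laplace-* (A zero) a (λ k → det (setRow (minor k A) i (v′ k))) ⟩
    a * laplace (A zero) (λ k → det (setRow (minor k A) i (v′ k)))    ≈⟨ *-congˡ (det-setRow-suc A i v) ⟨
    a * det (setRow A (suc i) v)                                      ∎
    where
    v′ : Fin (suc m) → Vec m
    v′ k j = v (punchIn k j)

  -- Expanding det A along its first two rows, the term deleting columns k and punchIn k l
  -- cancels the term deleting columns punchIn k l and partner k l: the same two columns
  -- are deleted, in the opposite order.

  partner : ∀ {n} → Fin (suc n) → Fin n → Fin n
  partner {suc n} zero    l       = zero
  partner {suc n} (suc k) zero    = k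
  partner {suc n} (suc k) (suc l) = suc (partner k l)

  punchIn-partner : ∀ {n} (k : Fin (suc n)) (l : Fin n) → punchIn (punchIn k l) (partner k l) ≡ k
  punchIn-partner {suc n} zero    l       = ≡.refl
  punchIn-partner {suc n} (suc k) zero    = ≡.refl
  punchIn-partner {suc n} (suc k) (suc l) = ≡.cong suc (punchIn-partner k l)

  punchIn-punchIn-partner : ∀ {n} (k : Fin (suc (suc n))) (l : Fin (suc n)) (x : Fin n) →
    punchIn k (punchIn l x) ≡ punchIn (punchIn k l) (punchIn (partner k l) x)
  punchIn-punchIn-partner zero    l       x       = ≡.refl
  punchIn-punchIn-partner (suc k) zero    x       = ≡.refl
  punchIn-punchIn-partner (suc k) (suc l) zero    = ≡.refl
  punchIn-punchIn-partner (suc k) (suc l) (suc x) = ≡.cong suc (punchIn-punchIn-partner k l x)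

  sgn-partner : ∀ {n} (k : Fin (suc n)) (l : Fin n) → sgn k * sgn l + sgn (punchIn k l) * sgn (partner k l) ≈ 0#
  sgn-partner {suc n} zero    l       = trans (+-cong (*-identityˡ _) (*-identityʳ _)) (-‿inverseʳ _)
  sgn-partner {suc n} (suc k) zero    = trans (+-cong (*-identityʳ _) (*-identityˡ _)) (-‿inverseˡ _)
  sgn-partner {suc n} (suc k) (suc l) = trans (solve 4 (λ a b x y → (:- a) :* (:- b) :+ (:- x) :* (:- y) := a :* b :+ x :* y)
                                                       refl (sgn k) (sgn l) _ _)
                                              (sgn-partner k l)

  Σ-partner-cancel : ∀ {n} (H : Fin (suc n) → Fin n → Carrier) →
    (∀ k l → H k l + H (punchIn k l) (partner k l) ≈ 0#) → Σ[< suc n ] (λ k → Σ[< n ] (H k)) ≈ 0#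
  Σ-partner-cancel {zero}  H cancel = +-identityˡ 0#
  Σ-partner-cancel {suc n} H cancel = begin
    Σ[< suc n ] (H zero) + Σ[< suc n ] (λ k → H (suc k) zero + Σ[< n ] (λ l → H (suc k) (suc l)))
      ≈⟨ +-congˡ (Σ-distrib-+ {suc n} (λ k → H (suc k) zero) (λ k → Σ[< n ] (λ l → H (suc k) (suc l)))) ⟩
    Σ[< suc n ] (H zero)
      + (Σ[< suc n ] (λ k → H (suc k) zero) + Σ[< suc n ] (λ k → Σ[< n ] (λ l → H (suc k) (suc l))))
      ≈⟨ +-congˡ (+-congˡ (Σ-partner-cancel (λ k l → H (suc k) (suc l)) (λ k l → cancel (suc k) (suc l)))) ⟩
    Σ[< suc n ] (H zero) + (Σ[< suc n ] (λ k → H (suc k) zero) + 0#)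
      ≈⟨ +-congˡ (+-identityʳ _) ⟩
    Σ[< suc n ] (H zero) + Σ[< suc n ] (λ k → H (suc k) zero)
      ≈⟨ Σ-distrib-+ {suc n} (H zero) (λ l → H (suc l) zero) ⟨
    Σ[< suc n ] (λ l → H zero l + H (suc l) zero)
      ≈⟨ Σ-zero {suc n} (cancel zero) ⟩
    0# ∎

  det-equalRows01 : ∀ {m} (A : Mat (suc (suc m))) → A zero ≈v A (suc zero) → det A ≈ 0#
  det-equalRows01 {m} A A₀≈A₁ =
    trans (Σ-cong {suc (suc m)} {g = λ k → Σ[< suc m ] (H k)} expand) (Σ-partner-cancel H cancel)
    where
    d : Fin (suc (suc m)) → Fin (suc m) → Carrier
    d k l = det (minor l (minor k A))
    H : Fin (suc (suc m)) → Fin (suc m) → Carrier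
    H k l = sgn k * (A zero k * (sgn l * (A (suc zero) (punchIn k l) * d k l)))
    expand : ∀ k → sgn k * (A zero k * det (minor k A)) ≈ Σ[< suc m ] (H k)
    expand k = trans (*-congˡ (*-distribˡ-Σ {suc m} (A zero k) (λ l → sgn l * (A (suc zero) (punchIn k l) * d k l))))
                     (*-distribˡ-Σ {suc m} (sgn k) (λ l → A zero k * (sgn l * (A (suc zero) (punchIn k l) * d k l))))
    cancel : ∀ k l → H k l + H (punchIn k l) (partner k l) ≈ 0#
    cancel k l = begin
      H k l + H k′ l′
        ≈⟨ +-congˡ (*-congˡ (*-cong (A₀≈A₁ k′) (*-congˡ (*-cong second-row same-minor)))) ⟩
      sgn k * (A zero k * (sgn l * (A (suc zero) k′ * d k l)))
        + sgn k′ * (A (suc zero) k′ * (sgn l′ * (A zero k * d k l)))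
        ≈⟨ solve 7 (λ a b a′ b′ x y e → a :* (x :* (b :* (y :* e))) :+ a′ :* (y :* (b′ :* (x :* e)))
                                       := (a :* b :+ a′ :* b′) :* (x :* (y :* e))) refl _ _ _ _ _ _ _ ⟩
      (sgn k * sgn l + sgn k′ * sgn l′) * (A zero k * (A (suc zero) k′ * d k l))
        ≈⟨ *-congʳ (sgn-partner k l) ⟩
      0# * (A zero k * (A (suc zero) k′ * d k l)) ≈⟨ zeroˡ _ ⟩
      0# ∎
      where
      k′ = punchIn k l
      l′ = partner k l
      second-row : A (suc zero) (punchIn k′ l′) ≈ A zero k
      second-row = trans (reflexive (≡.cong (A (suc zero)) (punchIn-partner k l))) (sym (A₀≈A₁ k))
      same-minor : d k′ l′ ≈ d k l
      same-minor = det-cong (λ i x → reflexive (≡.cong (A (suc (suc i))) (≡.sym (punchIn-punchIn-partner k l x))))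

  det-equalRows0 : ∀ {m} → IsAlternatingMultilinear (det {m}) →
    (A : Mat (suc m)) (j : Fin m) → A zero ≈v A (suc j) → det A ≈ 0#
  det-equalRows0 {suc m} det-isAM A zero    A₀≈Aⱼ = det-equalRows01 A A₀≈Aⱼ
  det-equalRows0 {suc m} det-isAM A (suc j) A₀≈Aⱼ = begin
    det A        ≈⟨ -‿involutive _ ⟨
    - - det A    ≈⟨ -‿cong det-swapped ⟨
    - det A′     ≈⟨ -‿cong (det-equalRows01 A′ rows01) ⟩
    - 0#         ≈⟨ -0#≈0# ⟩
    0#           ∎
    where
    open AlternatingMultilinear det-isAM using (swap)
    A₁ = setRow A (suc zero) (A (suc (suc j)))
    A′ = swapRows A (suc zero) (suc (suc j))
    rows01 : A′ zero ≈v A′ (suc zero)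
    rows01 x = trans (A₀≈Aⱼ x) (sym (trans (setRow-other A₁ {suc (suc j)} {suc zero} (A (suc zero)) (λ ()) x)
                                           (setRow-same A (suc zero) (A (suc (suc j))) x)))
    minor-swapRows : ∀ k → minor k A′ ≈M swapRows (minor k A) zero (suc j)
    minor-swapRows k = ≈M-trans (minor-setRow k A₁ (suc j) (A (suc zero)))
                                (setRow-congˡ (suc j) _ (minor-setRow k A zero (A (suc (suc j)))))
    det-swapped : det A′ ≈ - det A
    det-swapped = begin
      det A′                                     ≈⟨ laplace-congʳ (A zero) (λ k → trans (det-cong (minor-swapRows k))
                                                                                      (swap (minor k A) {zero} {suc j} (λ ()))) ⟩
      laplace (A zero) (λ k → - det (minor k A)) ≈⟨ laplace-neg (A zero) (λ k → det (minor k A)) ⟩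
      - det A                                    ∎

  det-alternating : ∀ {m} (A : Mat m) {i j} → i ≢ j → A i ≈v A j → det A ≈ 0#
  det-isAlternatingMultilinear : ∀ {m} → IsAlternatingMultilinear (det {m})

  det-alternating {suc m} A {zero}  {zero}  i≢j Aᵢ≈Aⱼ = ⊥-elim (i≢j ≡.refl)
  det-alternating {suc m} A {zero}  {suc j} i≢j Aᵢ≈Aⱼ =
    det-equalRows0 det-isAlternatingMultilinear A j Aᵢ≈Aⱼ
  det-alternating {suc m} A {suc i} {zero}  i≢j Aᵢ≈Aⱼ =
    det-equalRows0 det-isAlternatingMultilinear A i (λ x → sym (Aᵢ≈Aⱼ x))
  det-alternating {suc m} A {suc i} {suc j} i≢j Aᵢ≈Aⱼ = laplace-zero (A zero) (λ k →
    det-alternating (minor k A) (λ i≡j → i≢j (≡.cong suc i≡j)) (λ x → Aᵢ≈Aⱼ (punchIn k x)))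

  det-isAlternatingMultilinear = record
    { cong = det-cong ; additive = det-additive ; homogeneous = det-homogeneous ; alternating = det-alternating }

  -- Alternating multilinear functions are multiples of det

  insertZero : ∀ {m} → Fin (suc m) → Vec m → Vec (suc m)
  insertZero k v = insertAt v k 0#

  insertZero-cong : ∀ {m} (k : Fin (suc m)) {v w : Vec m} → v ≈v w → insertZero k v ≈v insertZero k w
  insertZero-cong zero          v≈w zero    = refl
  insertZero-cong zero          v≈w (suc x) = v≈w x
  insertZero-cong {suc m} (suc k) v≈w zero    = v≈w zero
  insertZero-cong {suc m} (suc k) v≈w (suc x) = insertZero-cong k (λ y → v≈w (suc y)) x

  insertZero-+ᵥ : ∀ {m} (k : Fin (suc m)) (v w : Vec m) → insertZero k (v +ᵥ w) ≈v (insertZero k v +ᵥ insertZero k w)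
  insertZero-+ᵥ zero            v w zero    = sym (+-identityˡ 0#)
  insertZero-+ᵥ zero            v w (suc x) = refl
  insertZero-+ᵥ {suc m} (suc k) v w zero    = refl
  insertZero-+ᵥ {suc m} (suc k) v w (suc x) = insertZero-+ᵥ k _ _ x

  insertZero-*ᵥ : ∀ {m} (k : Fin (suc m)) a (v : Vec m) → insertZero k (a *ᵥ v) ≈v (a *ᵥ insertZero k v)
  insertZero-*ᵥ zero            a v zero    = sym (zeroʳ a)
  insertZero-*ᵥ zero            a v (suc x) = refl
  insertZero-*ᵥ {suc m} (suc k) a v zero    = refl
  insertZero-*ᵥ {suc m} (suc k) a v (suc x) = insertZero-*ᵥ k a _ x

  insertZero-0v : ∀ {m} (k : Fin (suc m)) → insertZero k (0v {m}) ≈v 0v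
  insertZero-0v zero            zero    = refl
  insertZero-0v zero            (suc x) = refl
  insertZero-0v {suc m} (suc k) zero    = refl
  insertZero-0v {suc m} (suc k) (suc x) = insertZero-0v k x

  insertZero-1M : ∀ {m} (k : Fin (suc m)) (i : Fin m) → insertZero k (1M i) ≈v 1M (punchIn k i)
  insertZero-1M zero            i       zero    = refl
  insertZero-1M zero            i       (suc x) = refl
  insertZero-1M {suc m} (suc k) zero    zero    = refl
  insertZero-1M {suc m} (suc k) (suc i) zero    = refl
  insertZero-1M {suc m} (suc k) zero    (suc x) = insertZero-0v k x
  insertZero-1M {suc m} (suc k) (suc i) (suc x) = insertZero-1M k i x

  clearEntry : ∀ {m} (k : Fin (suc m)) (r : Vec (suc m)) → (r +ᵥ (- r k) *ᵥ 1M k) ≈v insertZero k (λ y → r (punchIn k y))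
  clearEntry zero            r zero    = trans (+-congˡ (*-identityʳ _)) (-‿inverseʳ _)
  clearEntry zero            r (suc x) = trans (+-congˡ (zeroʳ _)) (+-identityʳ _)
  clearEntry {suc m} (suc k) r zero    = trans (+-congˡ (zeroʳ _)) (+-identityʳ _)
  clearEntry {suc m} (suc k) r (suc x) = clearEntry k (λ y → r (suc y)) x

  extend : ∀ {m} → Fin (suc m) → Mat m → Mat (suc m)
  extend k M zero    = 1M k
  extend k M (suc i) = insertZero k (M i)

  extend-setRow : ∀ {m} (k : Fin (suc m)) (M : Mat m) i v →
    extend k (setRow M i v) ≈M setRow (extend k M) (suc i) (insertZero k v)
  extend-setRow k M i v zero    x = refl
  extend-setRow k M i v (suc r) x =
    reflexive (≡.cong-app (Vector.map-updateAt {f = insertZero k} (λ _ → ≡.refl) M i r) x)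

  extend-isAlternatingMultilinear : ∀ {m} {D : Mat (suc m) → Carrier} → IsAlternatingMultilinear D →
    ∀ k → IsAlternatingMultilinear (λ M → D (extend k M))
  extend-isAlternatingMultilinear {m} {D} isAM k = record
    { cong        = λ M≈N → cong (λ { zero x → refl ; (suc i) x → insertZero-cong k (M≈N i) x })
    ; additive    = λ M i v w → begin
        D (extend k (setRow M i (v +ᵥ w)))                            ≈⟨ cong (extend-setRow k M i _) ⟩
        D (setRow (extend k M) (suc i) (insertZero k (v +ᵥ w)))       ≈⟨ cong (setRow-cong _ (suc i) (insertZero-+ᵥ k v w)) ⟩
        D (setRow (extend k M) (suc i) (insertZero k v +ᵥ insertZero k w)) ≈⟨ additive _ (suc i) _ _ ⟩
        D (setRow (extend k M) (suc i) (insertZero k v)) + D (setRow (extend k M) (suc i) (insertZero k w))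
          ≈⟨ +-cong (cong (extend-setRow k M i v)) (cong (extend-setRow k M i w)) ⟨
        D (extend k (setRow M i v)) + D (extend k (setRow M i w))     ∎
    ; homogeneous = λ M i a v → begin
        D (extend k (setRow M i (a *ᵥ v)))                            ≈⟨ cong (extend-setRow k M i _) ⟩
        D (setRow (extend k M) (suc i) (insertZero k (a *ᵥ v)))       ≈⟨ cong (setRow-cong _ (suc i) (insertZero-*ᵥ k a v)) ⟩
        D (setRow (extend k M) (suc i) (a *ᵥ insertZero k v))         ≈⟨ homogeneous _ (suc i) a _ ⟩
        a * D (setRow (extend k M) (suc i) (insertZero k v))          ≈⟨ *-congˡ (cong (extend-setRow k M i v)) ⟨
        a * D (extend k (setRow M i v))                               ∎
    ; alternating = λ M i≢j Mᵢ≈Mⱼ →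
        alternating (extend k M) (λ i≡j → i≢j (Fin.suc-injective i≡j)) (insertZero-cong k Mᵢ≈Mⱼ)
    }
    where open AlternatingMultilinear isAM

  punchIn-suc-self : ∀ {n} (k : Fin n) → punchIn (suc k) k ≡ inject₁ k
  punchIn-suc-self zero    = ≡.refl
  punchIn-suc-self (suc k) = ≡.cong suc (punchIn-suc-self k)

  punchIn-inject₁-self : ∀ {n} (k : Fin n) → punchIn (inject₁ k) k ≡ suc k
  punchIn-inject₁-self zero    = ≡.refl
  punchIn-inject₁-self (suc k) = ≡.cong suc (punchIn-inject₁-self k)

  punchIn-suc≡punchIn-inject₁ : ∀ {n} {k r : Fin n} → k ≢ r → punchIn (suc k) r ≡ punchIn (inject₁ k) r
  punchIn-suc≡punchIn-inject₁ {k = zero}  {zero}  k≢r = ⊥-elim (k≢r ≡.refl)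
  punchIn-suc≡punchIn-inject₁ {k = zero}  {suc r} k≢r = ≡.refl
  punchIn-suc≡punchIn-inject₁ {k = suc k} {zero}  k≢r = ≡.refl
  punchIn-suc≡punchIn-inject₁ {k = suc k} {suc r} k≢r =
    ≡.cong suc (punchIn-suc≡punchIn-inject₁ (λ k≡r → k≢r (≡.cong suc k≡r)))

  sgn-inject₁ : ∀ {n} (k : Fin n) → sgn (inject₁ k) ≈ sgn k
  sgn-inject₁ zero    = refl
  sgn-inject₁ (suc k) = -‿cong (sgn-inject₁ k)

  moveToTop : ∀ {m} → Fin (suc m) → Mat (suc m)
  moveToTop k zero    = 1M k
  moveToTop k (suc i) = 1M (punchIn k i)

  extend-1M : ∀ {m} (k : Fin (suc m)) → extend k 1M ≈M moveToTop k
  extend-1M k zero    x = refl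
  extend-1M k (suc i) x = insertZero-1M k i x

  addMultiplesOfRow0 : ∀ {m} → Mat (suc m) → (Fin m → Carrier) → Mat (suc m)
  addMultiplesOfRow0 B t zero    = B zero
  addMultiplesOfRow0 B t (suc i) = B (suc i) +ᵥ t i *ᵥ B zero

  module _ {m} {D : Mat (suc m) → Carrier} (isAM : IsAlternatingMultilinear D) where
    open AlternatingMultilinear isAM

    -- Induction on a bound s for the rows with a nonzero multiplier, clearing row s at each step.
    D-addMultiplesOfRow0′ : ∀ s B t → (∀ i → s ℕ.≤ toℕ i → t i ≈ 0#) → D (addMultiplesOfRow0 B t) ≈ D B
    D-addMultiplesOfRow0′ zero B t t≈0 = cong λ
      { zero x → refl ; (suc i) x → trans (+-congˡ (trans (*-congʳ (t≈0 i z≤n)) (zeroˡ _))) (+-identityʳ _) }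
    D-addMultiplesOfRow0′ (suc s) B t t≈0 with s ℕ.<? m
    ... | no s≮m = D-addMultiplesOfRow0′ s B t (λ i s≤i → ⊥-elim (s≮m (ℕ.≤-<-trans s≤i (Fin.toℕ<n i))))
    ... | yes s<m = begin
      D (addMultiplesOfRow0 B t)                        ≈⟨ cong B≈ ⟩
      D (setRow B′ (suc j) (B′ (suc j) +ᵥ t j *ᵥ B′ zero)) ≈⟨ addMultipleOfRow B′ {zero} {suc j} (t j) (λ ()) ⟩
      D B′                                              ≈⟨ D-addMultiplesOfRow0′ s B t′ t′≈0 ⟩
      D B                                               ∎
      where
      j = fromℕ< s<m
      t′ = updateAt t j (const 0#)
      B′ = addMultiplesOfRow0 B t′
      t′≈0 : ∀ i → s ℕ.≤ toℕ i → t′ i ≈ 0#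
      t′≈0 i s≤i with j Fin.≟ i
      ... | yes ≡.refl = reflexive (Vector.updateAt-updates j t)
      ... | no j≢i = trans (reflexive (Vector.updateAt-minimal i j t (λ i≡j → j≢i (≡.sym i≡j))))
                           (t≈0 i (ℕ.≤∧≢⇒< s≤i (λ s≡i → j≢i (Fin.toℕ-injective
                                                                 (≡.trans (Fin.toℕ-fromℕ< s<m) s≡i)))))
      B≈ : addMultiplesOfRow0 B t ≈M setRow B′ (suc j) (B′ (suc j) +ᵥ t j *ᵥ B′ zero)
      B≈ zero    x = refl
      B≈ (suc r) x with j Fin.≟ r
      ... | yes ≡.refl = sym (trans (setRow-same B′ (suc j) _ x)
          (+-congʳ (trans (+-congˡ (trans (*-congʳ (reflexive (Vector.updateAt-updates j t))) (zeroˡ _))) (+-identityʳ _))))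
      ... | no j≢r = sym (trans (setRow-other B′ _ (λ sj≡sr → j≢r (Fin.suc-injective sj≡sr)) x)
          (+-congˡ (*-congʳ (reflexive (Vector.updateAt-minimal r j t (λ r≡j → j≢r (≡.sym r≡j)))))))

    D-addMultiplesOfRow0 : ∀ B t → D (addMultiplesOfRow0 B t) ≈ D B
    D-addMultiplesOfRow0 B t = D-addMultiplesOfRow0′ m B t (λ i m≤i → ⊥-elim (ℕ.<⇒≱ (Fin.toℕ<n i) m≤i))

    D-moveToTop′ : ∀ s (k : Fin (suc m)) → toℕ k ≡ s → D (moveToTop k) ≈ sgn k * D 1M
    D-moveToTop′ s       zero    _ = trans (cong (λ { zero x → refl ; (suc i) x → refl })) (sym (*-identityˡ _))
    D-moveToTop′ zero    (suc k) ()
    D-moveToTop′ (suc s) (suc k) k≡s = begin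
      D (moveToTop (suc k))                          ≈⟨ -‿involutive _ ⟨
      - - D (moveToTop (suc k))                      ≈⟨ -‿cong (swap (moveToTop (suc k)) {zero} {suc k} (λ ())) ⟨
      - D (swapRows (moveToTop (suc k)) zero (suc k)) ≈⟨ -‿cong (cong swapped) ⟩
      - D (moveToTop (inject₁ k))                    ≈⟨ -‿cong (D-moveToTop′ s (inject₁ k)
                                                                     (≡.trans (Fin.toℕ-inject₁ k) (ℕ.suc-injective k≡s))) ⟩
      - (sgn (inject₁ k) * D 1M)                     ≈⟨ -‿distribˡ-* _ _ ⟩
      - sgn (inject₁ k) * D 1M                       ≈⟨ *-congʳ (-‿cong (sgn-inject₁ k)) ⟩
      sgn (suc k) * D 1M                             ∎
      where
      M₀ = setRow (moveToTop (suc k)) zero (moveToTop (suc k) (suc k))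
      swapped : swapRows (moveToTop (suc k)) zero (suc k) ≈M moveToTop (inject₁ k)
      swapped zero    x = reflexive (≡.cong (λ q → 1M q x) (punchIn-suc-self k))
      swapped (suc r) x with k Fin.≟ r
      ... | yes ≡.refl =
        trans (setRow-same M₀ (suc k) _ x) (reflexive (≡.cong (λ q → 1M q x) (≡.sym (punchIn-inject₁-self k))))
      ... | no k≢r = trans (setRow-other M₀ _ (λ sk≡sr → k≢r (Fin.suc-injective sk≡sr)) x)
                           (reflexive (≡.cong (λ q → 1M q x) (punchIn-suc≡punchIn-inject₁ k≢r)))

    D-moveToTop : ∀ k → D (moveToTop k) ≈ sgn k * D 1M
    D-moveToTop k = D-moveToTop′ (toℕ k) k ≡.refl

  alternatingMultilinear≈det : ∀ {m} {D : Mat m → Carrier} → IsAlternatingMultilinear D → ∀ A → D A ≈ det A * D 1M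
  alternatingMultilinear≈det {zero}  isAM A = trans (IsAlternatingMultilinear.cong isAM (λ ())) (sym (*-identityˡ _))
  alternatingMultilinear≈det {suc m} {D} isAM A = begin
    D A                                                         ≈⟨ cong (setRow-self A zero) ⟨
    D (setRow A zero (A zero))                                  ≈⟨ cong (setRow-cong A zero (λ x → Σ-1Mʳ x (A zero))) ⟨
    D (setRow A zero (λ x → Σ[< suc m ] (λ k → A zero k * 1M k x)))
                                                                ≈⟨ linearCombination (suc m) A zero (A zero) 1M ⟩
    Σ[< suc m ] (λ k → A zero k * D (setRow A zero (1M k)))
      ≈⟨ Σ-cong {suc m} {g = λ k → sgn k * (A zero k * (D 1M * det (minor k A)))}
                (λ k → trans (*-congˡ (unitRow k)) (reassociate _ _ _ _)) ⟩
    laplace (A zero) (λ k → D 1M * det (minor k A))             ≈⟨ laplace-* (A zero) (D 1M) (λ k → det (minor k A)) ⟩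
    D 1M * det A                                                ≈⟨ *-comm _ _ ⟩
    det A * D 1M                                                ∎
    where
    open AlternatingMultilinear isAM
    reassociate : ∀ a d s e → a * (d * (s * e)) ≈ s * (a * (e * d))
    reassociate = solve 4 (λ a d s e → a :* (d :* (s :* e)) := s :* (a :* (e :* d))) refl
    unitRow : ∀ k → D (setRow A zero (1M k)) ≈ det (minor k A) * (sgn k * D 1M)
    unitRow k = begin
      D A′                                     ≈⟨ D-addMultiplesOfRow0 isAM A′ (λ i → - A (suc i) k) ⟨
      D (addMultiplesOfRow0 A′ (λ i → - A (suc i) k))
                                               ≈⟨ cong (λ { zero x → refl ; (suc i) x → clearEntry k (A (suc i)) x }) ⟩
      D (extend k (minor k A))                 ≈⟨ alternatingMultilinear≈det (extend-isAlternatingMultilinear isAM k)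
                                                                             (minor k A) ⟩
      det (minor k A) * D (extend k 1M)        ≈⟨ *-congˡ (trans (cong (extend-1M k)) (D-moveToTop isAM k)) ⟩
      det (minor k A) * (sgn k * D 1M)         ∎
      where
      A′ = setRow A zero (1M k)

  -- One-sided inverses are two-sided

  rowTimes : ∀ {m} → Vec m → Mat m → Vec m
  rowTimes {m} x B j = Σ[< m ] (λ k → x k * B k j)

  setRow-*M : ∀ {m} (X B : Mat m) i x → (setRow X i x *M B) ≈M setRow (X *M B) i (rowTimes x B)
  setRow-*M X B i x = ≗⇒≈M (Vector.map-updateAt {f = λ row → rowTimes row B} (λ _ → ≡.refl) X i)

  *M-isAlternatingMultilinear : ∀ {m} (B : Mat m) → IsAlternatingMultilinear (λ X → det (X *M B))
  *M-isAlternatingMultilinear {m} B = record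
    { cong        = λ X≈Y → det-cong (*M-cong X≈Y ≈M-refl)
    ; additive    = λ X i v w → begin
        det (setRow X i (v +ᵥ w) *M B)                    ≈⟨ det-cong (setRow-*M X B i _) ⟩
        det (setRow (X *M B) i (rowTimes (v +ᵥ w) B))     ≈⟨ det-cong (setRow-cong (X *M B) i (λ j →
                                                               trans (Σ-cong {m} (λ k → distribʳ _ _ _)) (Σ-distrib-+ {m} _ _))) ⟩
        det (setRow (X *M B) i (rowTimes v B +ᵥ rowTimes w B)) ≈⟨ det-additive (X *M B) i _ _ ⟩
        det (setRow (X *M B) i (rowTimes v B)) + det (setRow (X *M B) i (rowTimes w B))
                                                          ≈⟨ +-cong (det-cong (setRow-*M X B i v)) (det-cong (setRow-*M X B i w)) ⟨
        det (setRow X i v *M B) + det (setRow X i w *M B) ∎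
    ; homogeneous = λ X i a v → begin
        det (setRow X i (a *ᵥ v) *M B)                    ≈⟨ det-cong (setRow-*M X B i _) ⟩
        det (setRow (X *M B) i (rowTimes (a *ᵥ v) B))     ≈⟨ det-cong (setRow-cong (X *M B) i (λ j →
                                                               trans (Σ-cong {m} (λ k → *-assoc _ _ _)) (sym (*-distribˡ-Σ {m} a _)))) ⟩
        det (setRow (X *M B) i (a *ᵥ rowTimes v B))       ≈⟨ det-homogeneous (X *M B) i a _ ⟩
        a * det (setRow (X *M B) i (rowTimes v B))        ≈⟨ *-congˡ (det-cong (setRow-*M X B i v)) ⟨
        a * det (setRow X i v *M B)                       ∎
    ; alternating = λ X i≢j Xᵢ≈Xⱼ → det-alternating (X *M B) i≢j (λ y → Σ-cong {m} (λ k → *-congʳ (Xᵢ≈Xⱼ k)))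
    }

  det-*M : ∀ {m} (A B : Mat m) → det (A *M B) ≈ det A * det B
  det-*M A B = trans (alternatingMultilinear≈det (*M-isAlternatingMultilinear B) A) (*-congˡ (det-cong (*M-identityˡ B)))

  det-1M : ∀ {m} → det (1M {m}) ≈ 1#
  det-1M {zero}  = refl
  det-1M {suc m} = trans (+-cong (trans (*-identityˡ _) (trans (*-identityˡ _) (det-1M {m})))
                                 (Σ-zero {m} (λ k → trans (*-congˡ (zeroˡ _)) (zeroʳ _))))
                         (+-identityʳ _)

  adjugate : ∀ {m} → Mat m → Mat m
  adjugate A k y = det (setRow A y (1M k))

  *M-adjugate : ∀ {m} (A : Mat m) i y → (A *M adjugate A) i y ≈ det A * 1M i y
  *M-adjugate {m} A i y = begin
    Σ[< m ] (λ k → A i k * det (setRow A y (1M k)))       ≈⟨ linearCombination m A y (A i) 1M ⟨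
    det (setRow A y (λ x → Σ[< m ] (λ k → A i k * 1M k x))) ≈⟨ det-cong (setRow-cong A y (λ x → Σ-1Mʳ x (A i))) ⟩
    det (setRow A y (A i))                                ≈⟨ cofactor-row (i Fin.≟ y) ⟩
    det A * 1M i y                                        ∎
    where
    open AlternatingMultilinear (det-isAlternatingMultilinear {m}) using (linearCombination)
    cofactor-row : Dec (i ≡ y) → det (setRow A y (A i)) ≈ det A * 1M i y
    cofactor-row (yes ≡.refl) = trans (det-cong (setRow-self A i)) (sym (trans (*-congˡ (1M-diag i)) (*-identityʳ _)))
    cofactor-row (no i≢y)     = trans (det-alternating (setRow A y (A i)) i≢y
                                        (λ x → trans (setRow-other A (A i) i≢y′ x) (sym (setRow-same A y (A i) x))))
                                      (sym (trans (*-congˡ (1M-≢ i≢y)) (zeroʳ _)))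
      where
      i≢y′ : y ≢ i
      i≢y′ y≡i = i≢y (≡.sym y≡i)

  rightInverse⇒leftInverse : ∀ {m} (A B : Mat m) → (A *M B) ≈M 1M → (B *M A) ≈M 1M
  rightInverse⇒leftInverse {m} A B AB≈1 = ≈M-trans (*M-cong ≈M-refl A≈R) BR≈1
    where
    detA*detB≈1 : det A * det B ≈ 1#
    detA*detB≈1 = trans (sym (det-*M A B)) (trans (det-cong AB≈1) (det-1M {m}))
    R : Mat m
    R i j = det A * adjugate B i j
    *-comm-middle : ∀ b d a → b * (d * a) ≈ d * (b * a)
    *-comm-middle = solve 3 (λ b d a → b :* (d :* a) := d :* (b :* a)) refl
    BR≈1 : (B *M R) ≈M 1M
    BR≈1 i j = begin
      Σ[< m ] (λ k → B i k * (det A * adjugate B k j))  ≈⟨ Σ-cong {m} (λ k → *-comm-middle (B i k) (det A) _) ⟩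
      Σ[< m ] (λ k → det A * (B i k * adjugate B k j))  ≈⟨ *-distribˡ-Σ {m} (det A) _ ⟨
      det A * (B *M adjugate B) i j                      ≈⟨ *-congˡ (*M-adjugate B i j) ⟩
      det A * (det B * 1M i j)                           ≈⟨ *-assoc _ _ _ ⟨
      (det A * det B) * 1M i j                           ≈⟨ trans (*-congʳ detA*detB≈1) (*-identityˡ _) ⟩
      1M i j                                             ∎
    A≈R : A ≈M R
    A≈R = ≈M-trans (≈M-sym (*M-identityʳ A)) (≈M-trans (*M-cong ≈M-refl (≈M-sym BR≈1))
            (≈M-trans (≈M-sym (*M-assoc A B R)) (≈M-trans (*M-cong AB≈1 ≈M-refl) (*M-identityˡ R))))

  ·v-cong : ∀ {n} {X Y : Mat n} {v w : Vec n} → X ≈M Y → v ≈v w → (X ·v v) ≈v (Y ·v w)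
  ·v-cong {n} X≈Y v≈w i = Σ-cong {n} (λ k → *-cong (X≈Y i k) (v≈w k))

  ·v-assoc : ∀ {n} (X Y : Mat n) w → (X ·v (Y ·v w)) ≈v ((X *M Y) ·v w)
  ·v-assoc {n} X Y w i = begin
    Σ[< n ] (λ j → X i j * Σ[< n ] (λ k → Y j k * w k))   ≈⟨ Σ-cong {n} (λ j → *-distribˡ-Σ {n} (X i j) _) ⟩
    Σ[< n ] (λ j → Σ[< n ] (λ k → X i j * (Y j k * w k))) ≈⟨ Σ-comm {n} {n} _ ⟩
    Σ[< n ] (λ k → Σ[< n ] (λ j → X i j * (Y j k * w k))) ≈⟨ Σ-cong {n} (λ k → Σ-cong {n} (λ j → *-assoc _ _ _)) ⟨
    Σ[< n ] (λ k → Σ[< n ] (λ j → X i j * Y j k * w k))   ≈⟨ Σ-cong {n} (λ k → *-distribʳ-Σ {n} (w k) _) ⟨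
    Σ[< n ] (λ k → Σ[< n ] (λ j → X i j * Y j k) * w k)   ∎

  ·v-1M : ∀ {n} (X : Mat n) j → (X ·v 1M j) ≈v (λ i → X i j)
  ·v-1M {n} X j i = trans (Σ-cong {n} (λ k → *-congˡ (1M-sym j k))) (Σ-1Mʳ j (X i))

  1M-·v : ∀ {n} (w : Vec n) → (1M ·v w) ≈v w
  1M-·v w i = Σ-1Mˡ i w

  bil-cong : ∀ {n} {X Y : Mat n} {v v′ w w′ : Vec n} → X ≈M Y → v ≈v v′ → w ≈v w′ → bil X v w ≈ bil Y v′ w′
  bil-cong {n} X≈Y v≈v′ w≈w′ =
    Σ-cong {n} (λ i → Σ-cong {n} (λ j → *-cong (v≈v′ i) (*-cong (X≈Y i j) (w≈w′ j))))

  bil-congʳ : ∀ {n} (X : Mat n) v {w w′} → w ≈v w′ → bil X v w ≈ bil X v w′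
  bil-congʳ X v w≈w′ = bil-cong {X = X} ≈M-refl (λ _ → refl) w≈w′

  bil-congˡ : ∀ {n} (X : Mat n) {v v′} w → v ≈v v′ → bil X v w ≈ bil X v′ w
  bil-congˡ X w v≈v′ = bil-cong {X = X} ≈M-refl v≈v′ (λ _ → refl)

  bil-+ᵥˡ : ∀ {n} (X : Mat n) v v′ w → bil X (v +ᵥ v′) w ≈ bil X v w + bil X v′ w
  bil-+ᵥˡ {n} X v v′ w = trans (Σ-cong {n} (λ i → trans (Σ-cong {n} (λ j → distribʳ _ _ _)) (Σ-distrib-+ {n} _ _)))
                               (Σ-distrib-+ {n} (λ i → Σ[< n ] (λ j → v i * (X i j * w j))) _)

  bil-+ᵥʳ : ∀ {n} (X : Mat n) v w w′ → bil X v (w +ᵥ w′) ≈ bil X v w + bil X v w′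
  bil-+ᵥʳ {n} X v w w′ = trans (Σ-cong {n} (λ i → trans (Σ-cong {n} (λ j →
      solve 4 (λ a b c d → a :* (b :* (c :+ d)) := a :* (b :* c) :+ a :* (b :* d)) refl (v i) (X i j) (w j) (w′ j)))
      (Σ-distrib-+ {n} _ _)))
    (Σ-distrib-+ {n} (λ i → Σ[< n ] (λ j → v i * (X i j * w j))) _)

  bil-*ᵥˡ : ∀ {n} (X : Mat n) a v w → bil X (a *ᵥ v) w ≈ a * bil X v w
  bil-*ᵥˡ {n} X a v w = trans (Σ-cong {n} (λ i → trans (Σ-cong {n} (λ j → *-assoc _ _ _)) (sym (*-distribˡ-Σ {n} a _))))
                              (sym (*-distribˡ-Σ {n} a _))

  bil-negʳ : ∀ {n} (X : Mat n) v w → bil X v (λ j → - w j) ≈ - bil X v w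
  bil-negʳ {n} X v w = trans (Σ-cong {n} (λ i → trans (Σ-cong {n} (λ j →
      trans (*-congˡ (sym (-‿distribʳ-* _ _))) (sym (-‿distribʳ-* _ _)))) (-‿distrib-Σ {n} _)))
    (-‿distrib-Σ {n} (λ i → Σ[< n ] (λ j → v i * (X i j * w j))))

  bil-0vʳ : ∀ {n} (X : Mat n) v → bil X v 0v ≈ 0#
  bil-0vʳ {n} X v = Σ-zero {n} (λ i → Σ-zero {n} (λ j → trans (*-congˡ (zeroʳ _)) (zeroʳ _)))

  bil-0M : ∀ {n} v w → bil (0M {n}) v w ≈ 0#
  bil-0M {n} v w = Σ-zero {n} (λ i → Σ-zero {n} (λ j → trans (*-congˡ (zeroˡ _)) (zeroʳ _)))

  bil-negM : ∀ {n} (X : Mat n) v w → bil (-M X) v w ≈ - bil X v w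
  bil-negM {n} X v w = trans (Σ-cong {n} (λ i → trans (Σ-cong {n} (λ j →
      trans (*-congˡ (sym (-‿distribˡ-* _ _))) (sym (-‿distribʳ-* _ _)))) (-‿distrib-Σ {n} _)))
    (-‿distrib-Σ {n} (λ i → Σ[< n ] (λ j → v i * (X i j * w j))))

  bil-1M : ∀ {n} (X : Mat n) p q → bil X (1M p) (1M q) ≈ X p q
  bil-1M {n} X p q = begin
    Σ[< n ] (λ i → Σ[< n ] (λ j → 1M p i * (X i j * 1M q j))) ≈⟨ Σ-cong {n} (λ i → *-distribˡ-Σ {n} (1M p i) _) ⟨
    Σ[< n ] (λ i → 1M p i * Σ[< n ] (λ j → X i j * 1M q j))   ≈⟨ Σ-cong {n} (λ i → *-congˡ (·v-1M X q i)) ⟩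
    Σ[< n ] (λ i → 1M p i * X i q)                            ≈⟨ Σ-1Mˡ p (λ i → X i q) ⟩
    X p q                                                     ∎

  alternating⇒skew : ∀ {n} (X : Mat n) → AlternatingForm X → ∀ v w → bil X v w ≈ - bil X w v
  alternating⇒skew X alt v w = +-inverseʳ-unique _ _ (begin
    bil X w v + bil X v w
      ≈⟨ +-cong (trans (+-congʳ (alt w)) (+-identityˡ _)) (trans (+-congˡ (alt v)) (+-identityʳ _)) ⟨
    (bil X w w + bil X w v) + (bil X v w + bil X v v) ≈⟨ +-cong (bil-+ᵥʳ X w w v) (bil-+ᵥʳ X v w v) ⟨
    bil X w (w +ᵥ v) + bil X v (w +ᵥ v)            ≈⟨ bil-+ᵥˡ X w v (w +ᵥ v) ⟨
    bil X (w +ᵥ v) (w +ᵥ v)                        ≈⟨ alt (w +ᵥ v) ⟩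
    0#                                             ∎)

  NondegenerateFormʳ : ∀ {n} → Mat n → Set (c ⊔ ℓ)
  NondegenerateFormʳ X = ∀ w → (∀ v → bil X v w ≈ 0#) → w ≈v 0v

  symmetric⇒nondegenerateʳ : ∀ {n} (X : Mat n) → SymmetricForm X → NondegenerateForm X → NondegenerateFormʳ X
  symmetric⇒nondegenerateʳ X symmetric nondegenerate w w⊥ = nondegenerate w (λ v → trans (symmetric w v) (w⊥ v))

  alternating⇒nondegenerateʳ : ∀ {n} (X : Mat n) → AlternatingForm X → NondegenerateForm X → NondegenerateFormʳ X
  alternating⇒nondegenerateʳ X alternating nondegenerate w w⊥ =
    nondegenerate w (λ v → trans (alternating⇒skew X alternating w v) (trans (-‿cong (w⊥ v)) -0#≈0#))

  module _ {n} {σ : Mat n → Mat n} (isInv : IsInvolutionFirstKind n σ) {B : Mat n} (adapted : AdaptedForm σ B) where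
    open IsInvolutionFirstKind isInv using (involutive)

    adaptedʳ : ∀ M v w → bil B (M ·v v) w ≈ bil B v (σ M ·v w)
    adaptedʳ M v w = sym (trans (adapted (σ M) v w) (bil-cong ≈M-refl (·v-cong (involutive M) (λ _ → refl)) (λ _ → refl)))

    -- v y * B p q = b(E_py v, e_q) = b(v, σ(E_py) e_q) for the matrix unit E_py, so a nonzero
    -- entry B p q forces every coordinate of a vector in the left radical to vanish.
    nonzero⇒nondegenerate : NonzeroForm B → NondegenerateForm B
    nonzero⇒nondegenerate (p , q , Bpq≉0) v v⊥ y = begin
      v y                          ≈⟨ *-identityʳ _ ⟨
      v y * 1#                     ≈⟨ *-congˡ Bpq*t≈1 ⟨
      v y * (B p q * t)            ≈⟨ *-assoc _ _ _ ⟨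
      v y * B p q * t              ≈⟨ *-congʳ coordinate ⟩
      bil B (E ·v v) (1M q) * t    ≈⟨ *-congʳ (trans (adaptedʳ E v (1M q)) (v⊥ _)) ⟩
      0# * t                       ≈⟨ zeroˡ t ⟩
      0#                           ∎
      where
      t = proj₁ (inverse (B p q) Bpq≉0)
      Bpq*t≈1 = proj₂ (inverse (B p q) Bpq≉0)
      E : Mat n
      E i k = 1M p i * 1M y k
      E·v : (E ·v v) ≈v (v y *ᵥ 1M p)
      E·v i = trans (Σ-cong {n} (λ k → *-assoc _ _ _)) (trans (sym (*-distribˡ-Σ {n} (1M p i) _))
                (trans (*-congˡ (Σ-1Mˡ y v)) (*-comm _ _)))
      coordinate : v y * B p q ≈ bil B (E ·v v) (1M q)
      coordinate = sym (trans (bil-congˡ B (1M q) E·v) (trans (bil-*ᵥˡ B (v y) (1M p) (1M q)) (*-congˡ (bil-1M B p q))))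

  module _ {n : ℕ} where
    top bottom : Vec (n ℕ.+ n) → Vec n
    top    v x = v (x ↑ˡ n)
    bottom v y = v (n ↑ʳ y)

    top-++ : ∀ (u w : Vec n) → top (u ++ w) ≈v u
    top-++ u w x = reflexive (Vector.lookup-++ˡ u w x)

    bottom-++ : ∀ (u w : Vec n) → bottom (u ++ w) ≈v w
    bottom-++ u w y = reflexive (Vector.lookup-++ʳ u w y)

    block : Mat2 n → Fin n ⊎ Fin n → Fin n ⊎ Fin n → Carrier
    block (mat2 a b c′ d) (inj₁ x) (inj₁ y) = a x y
    block (mat2 a b c′ d) (inj₁ x) (inj₂ y) = b x y
    block (mat2 a b c′ d) (inj₂ x) (inj₁ y) = c′ x y
    block (mat2 a b c′ d) (inj₂ x) (inj₂ y) = d x y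

    fromBlocks : Mat2 n → Mat (n ℕ.+ n)
    fromBlocks X i j = block X (splitAt n i) (splitAt n j)

    byBlocks : ∀ {p} {Q : Fin (n ℕ.+ n) → Set p} → (∀ x → Q (x ↑ˡ n)) → (∀ y → Q (n ↑ʳ y)) → ∀ i → Q i
    byBlocks {Q = Q} onTop onBottom i = ≡.subst Q (Fin.join-splitAt n n i) (byHalf (splitAt n i))
      where
      byHalf : (s : Fin n ⊎ Fin n) → Q (join n n s)
      byHalf (inj₁ x) = onTop x
      byHalf (inj₂ y) = onBottom y

    ≈2⇒≈M : ∀ {g h : Mat (n ℕ.+ n)} → toBlocks {n} g ≈2 toBlocks {n} h → g ≈M h
    ≈2⇒≈M {g} {h} (a≈ , b≈ , c≈ , d≈) =
      byBlocks {Q = λ i → ∀ j → g i j ≈ h i j} (λ x → byBlocks (a≈ x) (b≈ x)) (λ y → byBlocks (c≈ y) (d≈ y))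

    ≈M⇒≈2 : ∀ {g h : Mat (n ℕ.+ n)} → g ≈M h → toBlocks {n} g ≈2 toBlocks {n} h
    ≈M⇒≈2 g≈h = (λ x y → g≈h _ _) , (λ x y → g≈h _ _) , (λ x y → g≈h _ _) , (λ x y → g≈h _ _)

    ≈2-trans : ∀ {X Y Z : Mat2 n} → X ≈2 Y → Y ≈2 Z → X ≈2 Z
    ≈2-trans (a , b , c′ , d) (a′ , b′ , c″ , d′) =
      ≈M-trans a a′ , ≈M-trans b b′ , ≈M-trans c′ c″ , ≈M-trans d d′

    ≈2-sym : ∀ {X Y : Mat2 n} → X ≈2 Y → Y ≈2 X
    ≈2-sym (a , b , c′ , d) = ≈M-sym a , ≈M-sym b , ≈M-sym c′ , ≈M-sym d

    toBlocks-fromBlocks : ∀ X → toBlocks {n} (fromBlocks X) ≈2 X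
    toBlocks-fromBlocks X =
      (λ x y → reflexive (≡.cong₂ (block X) (Fin.splitAt-↑ˡ n x n) (Fin.splitAt-↑ˡ n y n))) ,
      (λ x y → reflexive (≡.cong₂ (block X) (Fin.splitAt-↑ˡ n x n) (Fin.splitAt-↑ʳ n n y))) ,
      (λ x y → reflexive (≡.cong₂ (block X) (Fin.splitAt-↑ʳ n n x) (Fin.splitAt-↑ˡ n y n))) ,
      (λ x y → reflexive (≡.cong₂ (block X) (Fin.splitAt-↑ʳ n n x) (Fin.splitAt-↑ʳ n n y)))

    toBlocks-*M : ∀ (g h : Mat (n ℕ.+ n)) → toBlocks {n} (g *M h) ≈2 (toBlocks {n} g *2 toBlocks {n} h)
    toBlocks-*M g h = (λ x y → Σ-splitAt n {n} _) , (λ x y → Σ-splitAt n {n} _) ,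
                      (λ x y → Σ-splitAt n {n} _) , (λ x y → Σ-splitAt n {n} _)

    *2-congˡ : ∀ (X : Mat2 n) {Y Z} → Y ≈2 Z → (X *2 Y) ≈2 (X *2 Z)
    *2-congˡ (mat2 a b c′ d) (a≈ , b≈ , c≈ , d≈) =
      (λ x y → +-cong (*M-cong {A = a} ≈M-refl a≈ x y) (*M-cong {A = b} ≈M-refl c≈ x y)) ,
      (λ x y → +-cong (*M-cong {A = a} ≈M-refl b≈ x y) (*M-cong {A = b} ≈M-refl d≈ x y)) ,
      (λ x y → +-cong (*M-cong {A = c′} ≈M-refl a≈ x y) (*M-cong {A = d} ≈M-refl c≈ x y)) ,
      (λ x y → +-cong (*M-cong {A = c′} ≈M-refl b≈ x y) (*M-cong {A = d} ≈M-refl d≈ x y))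

    toBlocks-1M : toBlocks {n} (1M {n ℕ.+ n}) ≈2 I2
    toBlocks-1M = 1M-↑ˡ , (λ x y → 1M-≢ (↑ˡ≢↑ʳ x y)) , (λ x y → 1M-≢ (λ e → ↑ˡ≢↑ʳ y x (≡.sym e))) , 1M-↑ʳ n
      where
      1M-↑ˡ : ∀ {m} (p q : Fin m) → 1M {m ℕ.+ n} (p ↑ˡ n) (q ↑ˡ n) ≈ 1M p q
      1M-↑ˡ zero    zero    = refl
      1M-↑ˡ zero    (suc q) = refl
      1M-↑ˡ (suc p) zero    = refl
      1M-↑ˡ (suc p) (suc q) = 1M-↑ˡ p q
      1M-↑ʳ : ∀ m (p q : Fin n) → 1M {m ℕ.+ n} (m ↑ʳ p) (m ↑ʳ q) ≈ 1M p q
      1M-↑ʳ zero    p q = refl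
      1M-↑ʳ (suc m) p q = 1M-↑ʳ m p q
      ↑ˡ≢↑ʳ : ∀ (x y : Fin n) → x ↑ˡ n ≢ n ↑ʳ y
      ↑ˡ≢↑ʳ x y e
        with ≡.trans (≡.sym (Fin.splitAt-↑ˡ n x n)) (≡.trans (≡.cong (splitAt n) e) (Fin.splitAt-↑ʳ n n y))
      ... | ()

    ·v-top : ∀ (g : Mat (n ℕ.+ n)) v →
      top (g ·v v) ≈v (Mat2.a (toBlocks {n} g) ·v top v +ᵥ Mat2.b (toBlocks {n} g) ·v bottom v)
    ·v-top g v x = Σ-splitAt n {n} _

    ·v-bottom : ∀ (g : Mat (n ℕ.+ n)) v →
      bottom (g ·v v) ≈v (Mat2.c' (toBlocks {n} g) ·v top v +ᵥ Mat2.d (toBlocks {n} g) ·v bottom v)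
    ·v-bottom g v y = Σ-splitAt n {n} _

    bil-blocks : ∀ (g : Mat (n ℕ.+ n)) v w → let open Mat2 (toBlocks {n} g) in
      bil g v w ≈ (bil a (top v) (top w) + bil b (top v) (bottom w))
                  + (bil c' (bottom v) (top w) + bil d (bottom v) (bottom w))
    bil-blocks g v w = trans (Σ-splitAt n {n} _) (+-cong (halves (λ i → i ↑ˡ n)) (halves (n ↑ʳ_)))
      where
      halves : (ι : Fin n → Fin (n ℕ.+ n)) →
        Σ[< n ] (λ x → Σ[< n ℕ.+ n ] (λ j → v (ι x) * (g (ι x) j * w j))) ≈
        bil (λ x y → g (ι x) (y ↑ˡ n)) (λ x → v (ι x)) (top w)
          + bil (λ x y → g (ι x) (n ↑ʳ y)) (λ x → v (ι x)) (bottom w)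
      halves ι = trans (Σ-cong {n} (λ x → Σ-splitAt n {n} _)) (Σ-distrib-+ {n} _ _)

  -- The form Ω = [[0 , B] , [-B , 0]] on K^(n+n) and the adjoint τ g of g with respect to Ω

  -‿M-·v : ∀ {n} (X : Mat n) w → ((-M X) ·v w) ≈v (λ i → - (X ·v w) i)
  -‿M-·v {n} X w i = trans (Σ-cong {n} (λ k → sym (-‿distribˡ-* _ _))) (-‿distrib-Σ {n} _)

  module SplitForm {n} {σ : Mat n → Mat n} (isInv : IsInvolutionFirstKind n σ) {B : Mat n}
                   (adapted : AdaptedForm σ B) (nondegenerate : NondegenerateForm B) where

    Ω : Mat (n ℕ.+ n)
    Ω = fromBlocks (mat2 0M B (-M B) 0M)

    τ : Mat (n ℕ.+ n) → Mat (n ℕ.+ n)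
    τ g = fromBlocks (σhat σ (toBlocks g))

    bil-Ω : ∀ v w → bil Ω v w ≈ bil B (top v) (bottom w) - bil B (bottom v) (top w)
    bil-Ω v w = begin
      bil Ω v w
        ≈⟨ bil-blocks {n} Ω v w ⟩
      (bil a (top v) (top w) + bil b (top v) (bottom w)) + (bil c′ (bottom v) (top w) + bil d (bottom v) (bottom w))
        ≈⟨ +-cong (+-cong (trans (bil-cong {n} a≈ (λ _ → refl) (λ _ → refl)) (bil-0M {n} _ _))
                          (bil-cong {n} b≈ (λ _ → refl) (λ _ → refl)))
                  (+-cong (trans (bil-cong {n} c≈ (λ _ → refl) (λ _ → refl)) (bil-negM B _ _))
                          (trans (bil-cong {n} d≈ (λ _ → refl) (λ _ → refl)) (bil-0M {n} _ _))) ⟩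
      (0# + bil B (top v) (bottom w)) + (- bil B (bottom v) (top w) + 0#)
        ≈⟨ +-cong (+-identityˡ _) (+-identityʳ _) ⟩
      bil B (top v) (bottom w) - bil B (bottom v) (top w) ∎
      where
      open Mat2 (toBlocks {n} Ω) renaming (c' to c′)
      blocks≈ = toBlocks-fromBlocks (mat2 0M B (-M B) 0M)
      a≈ = proj₁ blocks≈
      b≈ = proj₁ (proj₂ blocks≈)
      c≈ = proj₁ (proj₂ (proj₂ blocks≈))
      d≈ = proj₂ (proj₂ (proj₂ blocks≈))

    Ω-nondegenerate : NondegenerateForm Ω
    Ω-nondegenerate v v⊥ =
      byBlocks {Q = λ i → v i ≈ 0#} (nondegenerate (top v) top⊥) (nondegenerate (bottom v) bottom⊥)
      where
      top⊥ : ∀ u → bil B (top v) u ≈ 0#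
      top⊥ u = begin
        bil B (top v) u                                 ≈⟨ +-identityʳ _ ⟨
        bil B (top v) u + 0#                            ≈⟨ +-congˡ (trans (-‿cong (bil-0vʳ B (bottom v))) -0#≈0#) ⟨
        bil B (top v) u - bil B (bottom v) 0v           ≈⟨ +-cong (bil-congʳ B (top v) (bottom-++ 0v u))
                                                                  (-‿cong (bil-congʳ B (bottom v) (top-++ 0v u))) ⟨
        bil B (top v) (bottom (0v ++ u)) - bil B (bottom v) (top (0v ++ u)) ≈⟨ bil-Ω v _ ⟨
        bil Ω v (0v ++ u)                               ≈⟨ v⊥ _ ⟩
        0#                                              ∎
      bottom⊥ : ∀ u → bil B (bottom v) u ≈ 0#
      bottom⊥ u = -‿injective (begin
        - bil B (bottom v) u                            ≈⟨ +-identityˡ _ ⟨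
        0# - bil B (bottom v) u                         ≈⟨ +-congʳ (bil-0vʳ B (top v)) ⟨
        bil B (top v) 0v - bil B (bottom v) u           ≈⟨ +-cong (bil-congʳ B (top v) (bottom-++ u 0v))
                                                                  (-‿cong (bil-congʳ B (bottom v) (top-++ u 0v))) ⟨
        bil B (top v) (bottom (u ++ 0v)) - bil B (bottom v) (top (u ++ 0v)) ≈⟨ bil-Ω v _ ⟨
        bil Ω v (u ++ 0v)                               ≈⟨ v⊥ _ ⟩
        0#                                              ≈⟨ -0#≈0# ⟨
        - 0#                                            ∎)

    Ω-alternating : SymmetricForm B → AlternatingForm Ω
    Ω-alternating symmetric v = trans (bil-Ω v v) (trans (+-congʳ (symmetric _ _)) (-‿inverseʳ _))

    Ω-symmetric : AlternatingForm B → SymmetricForm Ω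
    Ω-symmetric alternating v w = begin
      bil Ω v w                                             ≈⟨ bil-Ω v w ⟩
      bil B (top v) (bottom w) - bil B (bottom v) (top w)   ≈⟨ +-cong (skew _ _) (-‿cong (skew _ _)) ⟩
      - bil B (bottom w) (top v) - - bil B (top w) (bottom v) ≈⟨ solve 2 (λ x y → :- x :- :- y := y :- x) refl _ _ ⟩
      bil B (top w) (bottom v) - bil B (bottom w) (top v)   ≈⟨ bil-Ω w v ⟨
      bil Ω w v                                             ∎
      where
      skew = alternating⇒skew B alternating

    ·v-τ-top : ∀ g u → let open Mat2 (toBlocks {n} g) in
      top (τ g ·v u) ≈v (σ d ·v top u +ᵥ (-M σ b) ·v bottom u)
    ·v-τ-top g u x = trans (·v-top (τ g) u x) (+-cong (·v-cong (proj₁ τ-blocks) (λ _ → refl) x)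
                                                       (·v-cong (proj₁ (proj₂ τ-blocks)) (λ _ → refl) x))
      where τ-blocks = toBlocks-fromBlocks (σhat σ (toBlocks {n} g))

    ·v-τ-bottom : ∀ g u → let open Mat2 (toBlocks {n} g) in
      bottom (τ g ·v u) ≈v ((-M σ c') ·v top u +ᵥ σ a ·v bottom u)
    ·v-τ-bottom g u y = trans (·v-bottom (τ g) u y) (+-cong (·v-cong (proj₁ (proj₂ (proj₂ τ-blocks))) (λ _ → refl) y)
                                                             (·v-cong (proj₂ (proj₂ (proj₂ τ-blocks))) (λ _ → refl) y))
      where τ-blocks = toBlocks-fromBlocks (σhat σ (toBlocks {n} g))

    Ω-adjoint : ∀ g v u → bil Ω (g ·v v) u ≈ bil Ω v (τ g ·v u)
    Ω-adjoint g v u = begin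
      bil Ω (g ·v v) u
        ≈⟨ bil-Ω _ _ ⟩
      bil B (top (g ·v v)) u₂ - bil B (bottom (g ·v v)) u₁
        ≈⟨ +-cong (bil-congˡ B u₂ (·v-top g v)) (-‿cong (bil-congˡ B u₁ (·v-bottom g v))) ⟩
      bil B (a ·v v₁ +ᵥ b ·v v₂) u₂ - bil B (c′ ·v v₁ +ᵥ d ·v v₂) u₁
        ≈⟨ +-cong (bil-+ᵥˡ B _ _ u₂) (-‿cong (bil-+ᵥˡ B _ _ u₁)) ⟩
      (bil B (a ·v v₁) u₂ + bil B (b ·v v₂) u₂) - (bil B (c′ ·v v₁) u₁ + bil B (d ·v v₂) u₁)
        ≈⟨ +-cong (+-cong (adaptedʳ isInv adapted a v₁ u₂) (adaptedʳ isInv adapted b v₂ u₂))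
                  (-‿cong (+-cong (adaptedʳ isInv adapted c′ v₁ u₁) (adaptedʳ isInv adapted d v₂ u₁))) ⟩
      (bil B v₁ (σ a ·v u₂) + bil B v₂ (σ b ·v u₂)) - (bil B v₁ (σ c′ ·v u₁) + bil B v₂ (σ d ·v u₁))
        ≈⟨ solve 4 (λ p q r s → (p :+ q) :- (r :+ s) := (:- r :+ p) :- (s :+ :- q)) refl _ _ _ _ ⟩
      (- bil B v₁ (σ c′ ·v u₁) + bil B v₁ (σ a ·v u₂)) - (bil B v₂ (σ d ·v u₁) + - bil B v₂ (σ b ·v u₂))
        ≈⟨ +-cong (+-congʳ (bil-negʳ B v₁ _)) (-‿cong (+-congˡ (bil-negʳ B v₂ _))) ⟨
      (bil B v₁ (-σc′u₁) + bil B v₁ (σ a ·v u₂)) - (bil B v₂ (σ d ·v u₁) + bil B v₂ (-σbu₂))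
        ≈⟨ +-cong (bil-+ᵥʳ B v₁ _ _) (-‿cong (bil-+ᵥʳ B v₂ _ _)) ⟨
      bil B v₁ (-σc′u₁ +ᵥ σ a ·v u₂) - bil B v₂ (σ d ·v u₁ +ᵥ -σbu₂)
        ≈⟨ +-cong (bil-congʳ B v₁ τ-bottom) (-‿cong (bil-congʳ B v₂ τ-top)) ⟨
      bil B v₁ (bottom (τ g ·v u)) - bil B v₂ (top (τ g ·v u))
        ≈⟨ bil-Ω _ _ ⟨
      bil Ω v (τ g ·v u) ∎
      where
      open Mat2 (toBlocks {n} g) renaming (c' to c′)
      v₁ = top v
      v₂ = bottom v
      u₁ = top u
      u₂ = bottom u
      -σc′u₁ -σbu₂ : Vec n
      -σc′u₁ i = - (σ c′ ·v u₁) i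
      -σbu₂  i = - (σ b ·v u₂) i
      τ-top : top (τ g ·v u) ≈v (σ d ·v u₁ +ᵥ -σbu₂)
      τ-top x = trans (·v-τ-top g u x) (+-congˡ (-‿M-·v (σ b) u₂ x))
      τ-bottom : bottom (τ g ·v u) ≈v (-σc′u₁ +ᵥ σ a ·v u₂)
      τ-bottom y = trans (·v-τ-bottom g u y) (+-congʳ (-‿M-·v (σ c′) u₁ y))

    InSLσ⇔τ-rightInverse : ∀ g → InSLσ σ (toBlocks g) ⇔ (g *M τ g) ≈M 1M
    InSLσ⇔τ-rightInverse g = mk⇔
      (λ inSL → ≈2⇒≈M (≈2-trans product≈ (≈2-trans inSL (≈2-sym toBlocks-1M))))
      (λ g*τg≈1 → ≈2-trans (≈2-sym product≈) (≈2-trans (≈M⇒≈2 g*τg≈1) toBlocks-1M))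
      where
      product≈ : toBlocks (g *M τ g) ≈2 (toBlocks g *2 σhat σ (toBlocks g))
      product≈ = ≈2-trans (toBlocks-*M g (τ g)) (*2-congˡ (toBlocks g) (toBlocks-fromBlocks _))

    Preserves⇔τ-leftInverse : NondegenerateFormʳ Ω →
      ∀ g → Preserves Ω g ⇔ (τ g *M g) ≈M 1M
    Preserves⇔τ-leftInverse Ω-nondegenerateʳ g = mk⇔ τg*g≈1 preserves
      where
      T = τ g *M g
      bil-g : ∀ v w → bil Ω (g ·v v) (g ·v w) ≈ bil Ω v (T ·v w)
      bil-g v w = trans (Ω-adjoint g v (g ·v w)) (bil-congʳ Ω v (·v-assoc (τ g) g w))
      preserves : T ≈M 1M → Preserves Ω g
      preserves T≈1 v w = trans (bil-g v w) (bil-congʳ Ω v (λ i → trans (·v-cong T≈1 (λ _ → refl) i) (1M-·v w i)))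
      τg*g≈1 : Preserves Ω g → T ≈M 1M
      τg*g≈1 pres i j = begin
        T i j             ≈⟨ ·v-1M T j i ⟨
        (T ·v 1M j) i     ≈⟨ x∙y⁻¹≈ε⇒x≈y _ _ (Ω-nondegenerateʳ (T ·v 1M j +ᵥ -eⱼ) difference⊥ i) ⟩
        1M j i            ≈⟨ 1M-sym j i ⟩
        1M i j            ∎
        where
        -eⱼ : Vec (n ℕ.+ n)
        -eⱼ k = - 1M j k
        difference⊥ : ∀ v → bil Ω v (T ·v 1M j +ᵥ -eⱼ) ≈ 0#
        difference⊥ v = begin
          bil Ω v (T ·v 1M j +ᵥ -eⱼ)              ≈⟨ bil-+ᵥʳ Ω v _ _ ⟩
          bil Ω v (T ·v 1M j) + bil Ω v -eⱼ       ≈⟨ +-cong (trans (sym (bil-g v (1M j))) (pres v (1M j)))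
                                                            (bil-negʳ Ω v (1M j)) ⟩
          bil Ω v (1M j) - bil Ω v (1M j)         ≈⟨ -‿inverseʳ _ ⟩
          0#                                      ∎

    InSLσ⇔Preserves : NondegenerateFormʳ Ω → ∀ g → InSLσ σ (toBlocks g) ⇔ Preserves Ω g
    InSLσ⇔Preserves Ω-nondegenerateʳ g = mk⇔
      (λ inSL → Equivalence.from preserves⇔ (rightInverse⇒leftInverse g (τ g) (Equivalence.to inSL⇔ inSL)))
      (λ pres → Equivalence.from inSL⇔ (rightInverse⇒leftInverse (τ g) g (Equivalence.to preserves⇔ pres)))
      where
      inSL⇔ = InSLσ⇔τ-rightInverse g
      preserves⇔ = Preserves⇔τ-leftInverse Ω-nondegenerateʳ g

corollary3p3 : ∀ {c ℓ : Level} (K : Field c ℓ) →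
    let open FieldTheory K in
    AlgebraicallyClosed →
    (n : ℕ) (σ : Mat n → Mat n) → IsInvolutionFirstKind n σ →
      (Orthogonal σ →
        ∃[ B ] (NondegenerateForm {n ℕ.+ n} B × AlternatingForm B ×
                (∀ (g : Mat (n ℕ.+ n)) → InSLσ σ (toBlocks g) ⇔ Preserves B g)))
      × (Symplectic σ →
        ∃[ B ] (NondegenerateForm {n ℕ.+ n} B × SymmetricForm B ×
                (∀ (g : Mat (n ℕ.+ n)) → InSLσ σ (toBlocks g) ⇔ Preserves B g)))
corollary3p3 K _ n σ isInv =
  (λ { (B , nonzero , adapted , symmetric) →
         let open SplitForm isInv adapted (nonzero⇒nondegenerate isInv adapted nonzero)
         in Ω , Ω-nondegenerate , Ω-alternating symmetric ,
            InSLσ⇔Preserves (alternating⇒nondegenerateʳ Ω (Ω-alternating symmetric) Ω-nondegenerate) }) ,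
  (λ { (B , nonzero , adapted , alternating) →
         let open SplitForm isInv adapted (nonzero⇒nondegenerate isInv adapted nonzero)
         in Ω , Ω-nondegenerate , Ω-symmetric alternating ,
            InSLσ⇔Preserves (symmetric⇒nondegenerateʳ Ω (Ω-symmetric alternating) Ω-nondegenerate) })
  where open LinearAlgebra K
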